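{- Let $G$ be a multiple wheel with principal path $\overrightarrow{v_kv_1v_2}$ that has an even wheel as one of its components, where $v_3,\dots,v_{k-1}$ are the remaining vertices on the outer cycle of $G$ and $u_1,\dots,u_m$ are the vertices of $G$ not on the outer cycle. Then $P(G-\overrightarrow{v_kv_1v_2})$ contains a non-vanishing monomial $\eta\, v_1^0v_2^0v_k^0\prod_{i=3}^{k-1}v_i^{\alpha_i}\prod_{j=1}^m u_j^{\beta_j}$ with $\alpha_i\le2$ and $\beta_j\le4$.
   Context: For a graph $G$, vertices are also variables and $P(G)=\prod_{uv\in E(G),\,u<v}(u-v)$ for a fixed arbitrary orientation; a monomial is non-vanishing if its coefficient is nonzero. $G-\overrightarrow{v_kv_1v_2}$ is $G$ with edges $v_kv_1,v_1v_2$ deleted (vertices kept). An ordinary wheel consists of a cycle $v_1\dots v_kv_1$ ($k\ge3$) and a vertex adjacent to all $v_i$; it is even if $k$ is even and odd if $k$ is odd. A broken wheel consists of a path $v_2\dots v_k$ ($k\ge3$) and a vertex $v_1$ adjacent to all of $v_2,\dots,v_k$. For both, $\overrightarrow{v_kv_1v_2}$ is the principal path, $v_kv_1,v_1v_2$ the principal edges, $v_1,v_2,v_k$ the principal vertices. A double wheel is obtained from two graphs, each an ordinary or broken wheel, by identifying their vertices $v_1$ and identifying a principal edge of one with a principal edge of the other (the two pieces on opposite sides of the identified edge in the plane); iterating (gluing further ordinary or broken wheels along a principal edge at $v_1$) gives multiple wheels, with at least one component an ordinary wheel. The glued ordinary/broken wheels are the components; the common vertex is $v_1$, the two never-identified principal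 vertices are $v_2,v_k$, and $\overrightarrow{v_kv_1v_2}$ is the principal path of the multiple wheel. -}

module Defs where

open import Data.Bool using (Bool; true; false; if_then_else_)
open import Data.Nat using (ℕ; zero; suc; _+_; _∸_; _≡ᵇ_)
open import Data.List using (List; []; _∷_; _++_; map; length)
open import Data.Nat.ListAction using (sum)
open import Data.Product using (_×_; _,_)
open import Data.Integer using (ℤ; 0ℤ; 1ℤ; _-_)
open import Data.Nat.Divisibility using (_∣_)
open import Relation.Nullary using (¬_)
open import Relation.Nullary.Decidable using (⌊_⌋)
open import Data.Bool using (_∧_; _∨_; not)

-- Graphs: vertices are natural numbers, a graph is given by its edge list
-- (each pair (u , v) is an edge with the fixed orientation u - v).

Edge : Set
Edge = ℕ × ℕ

-- Exponent vectors: entry i of the list is the exponent of vertex i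
-- (vertices beyond the list length have exponent 0).
lookupD : List ℕ → ℕ → ℕ
lookupD []       _       = 0
lookupD (x ∷ xs) zero    = x
lookupD (x ∷ xs) (suc i) = lookupD xs i

decAt : ℕ → List ℕ → List ℕ
decAt _       []       = []
decAt zero    (x ∷ xs) = (x ∸ 1) ∷ xs
decAt (suc i) (x ∷ xs) = x ∷ decAt i xs

allZero : List ℕ → Bool
allZero []       = true
allZero (x ∷ xs) = (x ≡ᵇ 0) ∧ allZero xs

-- coeff E e = coefficient of the monomial ∏ᵢ xᵢ^(e i) in the polynomial
-- P = ∏_{(u , v) ∈ E} (x_u - x_v)  (expansion of the product, edge by edge:
-- [x^e] ((x_u - x_v) Q) = [x^(e - δ_u)] Q - [x^(e - δ_v)] Q).
coeff : List Edge → List ℕ → ℤ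
coeff []            e = if allZero e then 1ℤ else 0ℤ
coeff ((u , v) ∷ E) e = term u - term v
  where
  term : ℕ → ℤ
  term w = if lookupD e w ≡ᵇ 0 then 0ℤ else coeff E (decAt w e)

sameEdge : ℕ → ℕ → Edge → Bool
sameEdge a b (u , v) = ((u ≡ᵇ a) ∧ (v ≡ᵇ b)) ∨ ((u ≡ᵇ b) ∧ (v ≡ᵇ a))

deleteEdge : ℕ → ℕ → List Edge → List Edge
deleteEdge a b [] = []
deleteEdge a b (x ∷ E) = if sameEdge a b x then deleteEdge a b E else x ∷ deleteEdge a b E

-- Multiple wheels.
-- A component is an ordinary wheel (rim cycle v₁ … v_k plus a centre) or a
-- broken wheel (hub v₁ plus path v₂ … v_k), with parameter k ≥ 3.

data Kind : Set where
  ordinary broken : Kind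

record Comp : Set where
  constructor comp
  field
    kind : Kind
    size : ℕ
open Comp public

-- A multiple wheel is a chain of components c₁ , … , c_t glued at the common
-- vertex v₁ (label 0), consecutive components sharing a principal edge.
-- Labelling: v₁ = 0; the outer-cycle vertices other than v₁ are 1 , 2 , … , N
-- in order along the outer cycle (so v₂ = 1 and v_k = N, k = N + 1);
-- the vertices not on the outer cycle (centres of the ordinary components)
-- are N+1 , N+2 , … .
-- Component i occupies outer vertices s , … , s + (kᵢ - 2) where s is the
-- last outer vertex of component i-1 (the shared principal edge is v₁s).

outerEnd : List Comp → ℕ
outerEnd cs = 1 + sum (map (λ c → size c ∸ 2) cs)

countOrd : List Comp → ℕ
countOrd [] = 0
countOrd (comp ordinary _ ∷ cs) = suc (countOrd cs)
countOrd (comp broken _ ∷ cs) = countOrd cs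

nVerts : List Comp → ℕ
nVerts cs = 1 + outerEnd cs + countOrd cs

pathEdges : ℕ → ℕ → List Edge
pathEdges s zero    = []
pathEdges s (suc n) = (s , suc s) ∷ pathEdges (suc s) n

fan : ℕ → ℕ → ℕ → List Edge
fan w s zero    = []
fan w s (suc n) = (w , s) ∷ fan w (suc s) n

-- edges contributed by one component whose outer path starts at s,
-- whose centre (if ordinary) is c; the edge v₁s is only added for the
-- first component (otherwise it is the edge identified with the previous one).
compEdges : Bool → ℕ → ℕ → Comp → List Edge
compEdges first s c (comp ordinary k) =
  (if first then (0 , s) ∷ [] else []) ++
  (0 , s + (k ∸ 2)) ∷ (c , 0) ∷ fan c s (k ∸ 1) ++ pathEdges s (k ∸ 2)
compEdges first s c (comp broken k) =
  (if first then (0 , s) ∷ [] else []) ++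
  fan 0 (suc s) (k ∸ 2) ++ pathEdges s (k ∸ 2)

nextCentre : Comp → ℕ → ℕ
nextCentre (comp ordinary _) c = suc c
nextCentre (comp broken _)   c = c

buildEdges : Bool → ℕ → ℕ → List Comp → List Edge
buildEdges first s c []        = []
buildEdges first s c (x ∷ cs) =
  compEdges first s c x ++ buildEdges false (s + (size x ∸ 2)) (nextCentre x c) cs

multiWheel : List Comp → List Edge
multiWheel cs = buildEdges true 1 (suc (outerEnd cs)) cs

minusPrincipal : List Comp → List Edge
minusPrincipal cs = deleteEdge 0 (outerEnd cs) (deleteEdge 0 1 (multiWheel cs))

data IsEvenWheel : Comp → Set where
  evenWheel : ∀ {k} → 2 ∣ k → IsEvenWheel (comp ordinary k)

module Submission where

-- Since v₁ gets exponent 0, every edge v₁y left in G − v_kv₁v₂ must contribute y; removing these forced edges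
-- (up to sign) leaves a chain of blocks, one per component, consecutive blocks sharing one rim vertex: a path
-- for a broken wheel, a path plus the fan from its centre for an ordinary wheel. The coefficient of such a chain
-- factorises block by block. A path block with inner rim exponents 1 has one spare unit, sitting at one of its
-- ends, and contributes ±1. A fan block with inner rim exponents 2 is peeled two edges at a time; the resulting
-- recursion gives ±1 when an odd wheel has its spare unit at one end, and ±1 when an even wheel's centre takes
-- 3 and its ends nothing. So the spare units can be pushed towards the even wheel from both sides, leaving
-- exponent 0 at v₂ and v_k.

open import Defs
open import Data.Bool using (Bool; true; false; if_then_else_; _∧_; _∨_; not)
open import Data.Bool.Properties using (T-≡; ∨-zeroʳ)
open import Data.Empty using (⊥-elim)
open import Function using (_∘_; _$_; Equivalence)
open import Data.Integer using (ℤ; 0ℤ; 1ℤ; -1ℤ; -_; ∣_∣) renaming (_-_ to _-ℤ_; _*_ to _*ℤ_; _+_ to _+ℤ_)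
import Data.Integer.Properties as ℤ
open import Data.Integer.Solver using (module +-*-Solver)
open import Data.List using (List; []; _∷_; _++_; map; length)
open import Data.List.Relation.Unary.All using (All; []; _∷_)
open import Data.List.Relation.Unary.All.Properties using (++⁺)
open import Data.List.Relation.Unary.Any as Any using (Any; here; there)
open import Data.Nat using (ℕ; zero; suc; _+_; _∸_; _*_; _≡ᵇ_; _<ᵇ_; z≤n; s≤s; _≤_; _<_; _≤?_; _<?_; _≟_)
open import Data.Nat.Divisibility using (_∣_; divides)
open import Data.Nat.ListAction using (sum)
open import Data.Nat.Properties
open import Data.Product using (_×_; _,_; proj₁; proj₂; ∃-syntax)
open import Data.Sum using (_⊎_; inj₁; inj₂)
open import Relation.Binary.Definitions using (tri<; tri≈; tri>)
open import Relation.Binary.PropositionalEquality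
open import Relation.Nullary using (¬_; Dec; yes; no)

≡ᵇ-refl : ∀ n → (n ≡ᵇ n) ≡ true
≡ᵇ-refl zero    = refl
≡ᵇ-refl (suc n) = ≡ᵇ-refl n

≢⇒≡ᵇ-false : ∀ {m n} → m ≢ n → (m ≡ᵇ n) ≡ false
≢⇒≡ᵇ-false {zero}  {zero}  m≢n = ⊥-elim (m≢n refl)
≢⇒≡ᵇ-false {zero}  {suc n} m≢n = refl
≢⇒≡ᵇ-false {suc m} {zero}  m≢n = refl
≢⇒≡ᵇ-false {suc m} {suc n} m≢n = ≢⇒≡ᵇ-false (m≢n ∘ cong suc)

[_↦_] : ℕ → ℕ → ℕ → ℕ
[ w ↦ v ] y = if w ≡ᵇ y then v else 0

↦-here : ∀ w v → [ w ↦ v ] w ≡ v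
↦-here w v rewrite ≡ᵇ-refl w = refl

↦-elsewhere : ∀ {w v y} → w ≢ y → [ w ↦ v ] y ≡ 0
↦-elsewhere w≢y rewrite ≢⇒≡ᵇ-false w≢y = refl

_≐_ : List ℕ → List ℕ → Set
e ≐ e′ = ∀ y → lookupD e y ≡ lookupD e′ y

lookupD-decAt-same : ∀ w e → lookupD (decAt w e) w ≡ lookupD e w ∸ 1
lookupD-decAt-same w       []      = refl
lookupD-decAt-same zero    (x ∷ e) = refl
lookupD-decAt-same (suc w) (x ∷ e) = lookupD-decAt-same w e

lookupD-decAt-other : ∀ w y e → y ≢ w → lookupD (decAt w e) y ≡ lookupD e y
lookupD-decAt-other w       y       []      y≢w = refl
lookupD-decAt-other zero    zero    (x ∷ e) y≢w = ⊥-elim (y≢w refl)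
lookupD-decAt-other zero    (suc y) (x ∷ e) y≢w = refl
lookupD-decAt-other (suc w) zero    (x ∷ e) y≢w = refl
lookupD-decAt-other (suc w) (suc y) (x ∷ e) y≢w = lookupD-decAt-other w y e (y≢w ∘ cong suc)

lookupD-decAt-≤ : ∀ w e y → lookupD (decAt w e) y ≤ lookupD e y
lookupD-decAt-≤ w e y with y ≟ w
... | yes refl = ≤-trans (≤-reflexive (lookupD-decAt-same y e)) (m∸n≤m _ 1)
... | no y≢w   = ≤-reflexive (lookupD-decAt-other w y e y≢w)

decAt-comm : ∀ a b e → decAt a (decAt b e) ≡ decAt b (decAt a e)
decAt-comm a       b       []      = refl
decAt-comm zero    zero    (x ∷ e) = refl
decAt-comm zero    (suc b) (x ∷ e) = refl
decAt-comm (suc a) zero    (x ∷ e) = refl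
decAt-comm (suc a) (suc b) (x ∷ e) = cong (x ∷_) (decAt-comm a b e)

decAt-cong : ∀ w {e e′} → e ≐ e′ → decAt w e ≐ decAt w e′
decAt-cong w {e} {e′} e≐e′ y with y ≟ w
... | yes refl = trans (lookupD-decAt-same y e) (trans (cong (_∸ 1) (e≐e′ y)) (sym (lookupD-decAt-same y e′)))
... | no y≢w   = trans (lookupD-decAt-other w y e y≢w) (trans (e≐e′ y) (sym (lookupD-decAt-other w y e′ y≢w)))

allZero-false : ∀ e y → 0 < lookupD e y → allZero e ≡ false
allZero-false []          y       ()
allZero-false (zero ∷ e)  zero    ()
allZero-false (suc x ∷ e) zero    _  = refl
allZero-false (zero ∷ e)  (suc y) p  = allZero-false e y p
allZero-false (suc x ∷ e) (suc y) _  = refl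

allZero-true : ∀ e → (∀ y → lookupD e y ≡ 0) → allZero e ≡ true
allZero-true []      e≡0 = refl
allZero-true (x ∷ e) e≡0 rewrite e≡0 0 = allZero-true e (e≡0 ∘ suc)

allZero-cong : ∀ {e e′} → e ≐ e′ → allZero e ≡ allZero e′
allZero-cong {[]}    {[]}     h = refl
allZero-cong {[]}    {x ∷ e′} h rewrite sym (h 0) = allZero-cong {[]} {e′} (h ∘ suc)
allZero-cong {x ∷ e} {[]}     h rewrite h 0 = allZero-cong {e} {[]} (h ∘ suc)
allZero-cong {x ∷ e} {x′ ∷ e′} h rewrite h 0 = cong ((x′ ≡ᵇ 0) ∧_) (allZero-cong {e} {e′} (h ∘ suc))

suc[a∸1]≡a : ∀ {a} → a ≢ 0 → suc (a ∸ 1) ≡ a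
suc[a∸1]≡a {zero}  a≢0 = ⊥-elim (a≢0 refl)
suc[a∸1]≡a {suc a} _   = refl

∸1-< : ∀ {a d} → a ≢ 0 → a ≤ d → a ∸ 1 < d
∸1-< {zero}  a≢0 _   = ⊥-elim (a≢0 refl)
∸1-< {suc a} _   a<d = a<d

0<-of : ∀ {a n} → a ≡ suc n → 0 < a
0<-of a≡1+n = subst (0 <_) (sym a≡1+n) (s≤s z≤n)

decAt-preserves-0 : ∀ w e → lookupD e 0 ≡ 0 → lookupD (decAt w e) 0 ≡ 0
decAt-preserves-0 w e e0≡0 = n≤0⇒n≡0 (subst (lookupD (decAt w e) 0 ≤_) e0≡0 (lookupD-decAt-≤ w e 0))

Between : ℕ → ℕ → ℕ → Set
Between s t y = s ≤ y × y < t

between? : ∀ s t y → Dec (Between s t y)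
between? s t y with s ≤? y | y <? t
... | yes s≤y | yes y<t = yes (s≤y , y<t)
... | no s≰y  | _       = no (s≰y ∘ proj₁)
... | yes _   | no y≮t  = no (y≮t ∘ proj₂)

Between-single : ∀ {s y} → Between s (suc s) y → y ≡ s
Between-single (s≤y , y<1+s) = ≤-antisym (≤-pred y<1+s) s≤y

OutsideRim : ℕ → ℕ → ℕ → Set
OutsideRim s n y = y < s ⊎ s + n < y

outsideRim-shift : ∀ {s n y} → OutsideRim s (suc n) y → OutsideRim (suc s) n y
outsideRim-shift         (inj₁ y<s)   = inj₁ (m<n⇒m<1+n y<s)
outsideRim-shift {s} {n} {y} (inj₂ end<y) = inj₂ (subst (_< y) (+-suc s n) end<y)

outside-≢start : ∀ {s n y} → OutsideRim s n y → s ≢ y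
outside-≢start     (inj₁ y<s)   = <⇒≢ y<s ∘ sym
outside-≢start {s} {n} (inj₂ end<y) = <⇒≢ (≤-<-trans (m≤m+n s n) end<y)

outside-≢end : ∀ {s n y} → OutsideRim s n y → s + n ≢ y
outside-≢end {s} {n} (inj₁ y<s)   = <⇒≢ (<-≤-trans y<s (m≤m+n s n)) ∘ sym
outside-≢end         (inj₂ end<y) = <⇒≢ end<y

outside-Between : ∀ {s n y} → ¬ Between s (s + n) y → y ≢ s + n → OutsideRim s n y
outside-Between {s} {n} {y} y∉ y≢t with s ≤? y
... | no s≰y = inj₁ (≰⇒> s≰y)
... | yes s≤y with y <? s + n
...   | yes y<t = ⊥-elim (y∉ (s≤y , y<t))
...   | no y≮t  = inj₂ (≤∧≢⇒< (≮⇒≥ y≮t) (y≢t ∘ sym))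

≢-split : ∀ {c y} → y ≢ c → y < c ⊎ suc c ≤ y
≢-split {c} {y} y≢c with <-cmp y c
... | tri< y<c _ _ = inj₁ y<c
... | tri≈ _ y≡c _ = ⊥-elim (y≢c y≡c)
... | tri> _ _ c<y = inj₂ c<y

<⊎≥ : ∀ y c → y < c ⊎ c ≤ y
<⊎≥ y c with y <? c
... | yes y<c = inj₁ y<c
... | no y≮c  = inj₂ (≮⇒≥ y≮c)

-- Coefficients of products

CoeffFn : Set
CoeffFn = List ℕ → ℤ

-- coeffMul E k is the coefficient function of P_E · K when k is that of K; coeff E = coeffMul E one.
mutual
  coeffMul : List Edge → CoeffFn → CoeffFn
  coeffMul []            k e = k e
  coeffMul ((u , v) ∷ E) k e = choose E k e u -ℤ choose E k e v

  choose : List Edge → CoeffFn → List ℕ → ℕ → ℤ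
  choose E k e w = if lookupD e w ≡ᵇ 0 then 0ℤ else coeffMul E k (decAt w e)

one : CoeffFn
one e = if allZero e then 1ℤ else 0ℤ

choose-zero : ∀ E k e w → lookupD e w ≡ 0 → choose E k e w ≡ 0ℤ
choose-zero E k e w ew≡0 rewrite ew≡0 = refl

choose-suc : ∀ E k e w {n} → lookupD e w ≡ suc n → choose E k e w ≡ coeffMul E k (decAt w e)
choose-suc E k e w ew≡1+n rewrite ew≡1+n = refl

choose-vanish : ∀ E k e w → (lookupD e w ≢ 0 → coeffMul E k (decAt w e) ≡ 0ℤ) → choose E k e w ≡ 0ℤ
choose-vanish E k e w h with lookupD e w
... | zero  = refl
... | suc n = h (λ ())

coeff≡coeffMul-one : ∀ E e → coeff E e ≡ coeffMul E one e
coeff≡coeffMul-one []            e = refl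
coeff≡coeffMul-one ((u , v) ∷ E) e = cong₂ _-ℤ_ (branch u) (branch v)
  where
  branch : ∀ w → (if lookupD e w ≡ᵇ 0 then 0ℤ else coeff E (decAt w e)) ≡ choose E one e w
  branch w with lookupD e w ≡ᵇ 0
  ... | true  = refl
  ... | false = coeff≡coeffMul-one E (decAt w e)

coeff-++ : ∀ A B e → coeff (A ++ B) e ≡ coeffMul A (coeff B) e
coeff-++ []            B e = refl
coeff-++ ((u , v) ∷ A) B e = cong₂ _-ℤ_ (branch u) (branch v)
  where
  branch : ∀ w → (if lookupD e w ≡ᵇ 0 then 0ℤ else coeff (A ++ B) (decAt w e)) ≡ choose A (coeff B) e w
  branch w with lookupD e w ≡ᵇ 0
  ... | true  = refl
  ... | false = coeff-++ A B (decAt w e)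

coeff-[] : ∀ e → (∀ y → lookupD e y ≡ 0) → coeff [] e ≡ 1ℤ
coeff-[] e e≡0 rewrite allZero-true e e≡0 = refl

Avoids : ℕ → List Edge → Set
Avoids y = All (λ uv → proj₁ uv ≢ y × proj₂ uv ≢ y)

VanishesAt : ℕ → CoeffFn → Set
VanishesAt y k = ∀ e → 0 < lookupD e y → k e ≡ 0ℤ

VanishesOn : (ℕ → Set) → CoeffFn → Set
VanishesOn Z k = ∀ y → Z y → VanishesAt y k

coeffMul-vanish : ∀ {y} E k → Avoids y E → VanishesAt y k → VanishesAt y (coeffMul E k)
coeffMul-vanish []            k []                  k-van e ey>0 = k-van e ey>0
coeffMul-vanish {y} ((u , v) ∷ E) k ((u≢y , v≢y) ∷ av) k-van e ey>0 =
  cong₂ _-ℤ_ (branch u u≢y) (branch v v≢y)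
  where
  branch : ∀ w → w ≢ y → choose E k e w ≡ 0ℤ
  branch w w≢y = choose-vanish E k e w λ _ → coeffMul-vanish E k av k-van (decAt w e)
    (subst (0 <_) (sym (lookupD-decAt-other w y e (w≢y ∘ sym))) ey>0)

one-vanish : ∀ y → VanishesAt y one
one-vanish y e ey>0 rewrite allZero-false e y ey>0 = refl

coeff-vanish : ∀ {y} E → Avoids y E → VanishesAt y (coeff E)
coeff-vanish {y} E av e ey>0 =
  trans (coeff≡coeffMul-one E e) (coeffMul-vanish E one av (one-vanish y) e ey>0)

avoids-pathEdges : ∀ {s n y} → OutsideRim s n y → Avoids y (pathEdges s n)
avoids-pathEdges {n = zero}  out = []
avoids-pathEdges {s} {suc n} out =
  (outside-≢start out , outside-≢start (outsideRim-shift out)) ∷ avoids-pathEdges (outsideRim-shift out)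

avoids-fan : ∀ {c s n y} → c ≢ y → OutsideRim s n y → Avoids y (fan c s (suc n))
avoids-fan {n = zero}  c≢y out = (c≢y , outside-≢start out) ∷ []
avoids-fan {n = suc n} c≢y out = (c≢y , outside-≢start out) ∷ avoids-fan c≢y (outsideRim-shift out)

Congruent : CoeffFn → Set
Congruent k = ∀ e e′ → e ≐ e′ → k e ≡ k e′

coeffMul-congruent : ∀ E k → Congruent k → Congruent (coeffMul E k)
coeffMul-congruent []            k k-cong = k-cong
coeffMul-congruent ((u , v) ∷ E) k k-cong e e′ e≐e′ = cong₂ _-ℤ_ (branch u) (branch v)
  where
  branch : ∀ w → choose E k e w ≡ choose E k e′ w
  branch w rewrite e≐e′ w with lookupD e′ w ≡ᵇ 0
  ... | true  = refl
  ... | false = coeffMul-congruent E k k-cong (decAt w e) (decAt w e′) (decAt-cong w {e} {e′} e≐e′)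

one-congruent : Congruent one
one-congruent e e′ e≐e′ rewrite allZero-cong {e} {e′} e≐e′ = refl

coeff-congruent : ∀ E → Congruent (coeff E)
coeff-congruent E e e′ e≐e′ =
  trans (coeff≡coeffMul-one E e)
    (trans (coeffMul-congruent E one one-congruent e e′ e≐e′) (sym (coeff≡coeffMul-one E e′)))

choose₂ : List Edge → CoeffFn → List ℕ → ℕ → ℕ → ℤ
choose₂ E k e a b = if lookupD e a ≡ᵇ 0 then 0ℤ else choose E k (decAt a e) b

choose₂-comm : ∀ E k e a b → choose₂ E k e a b ≡ choose₂ E k e b a
choose₂-comm E k e a b with a ≟ b
... | yes refl = refl
... | no a≢b =
  begin
    (if lookupD e a ≡ᵇ 0 then 0ℤ else (if lookupD (decAt a e) b ≡ᵇ 0 then 0ℤ else coeffMul E k (decAt b (decAt a e))))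
  ≡⟨ cong₂ (λ p q → if lookupD e a ≡ᵇ 0 then 0ℤ else (if p ≡ᵇ 0 then 0ℤ else coeffMul E k q))
       (lookupD-decAt-other a b e (a≢b ∘ sym)) (decAt-comm b a e) ⟩
    (if lookupD e a ≡ᵇ 0 then 0ℤ else (if lookupD e b ≡ᵇ 0 then 0ℤ else coeffMul E k (decAt a (decAt b e))))
  ≡⟨ if-swap (lookupD e a ≡ᵇ 0) (lookupD e b ≡ᵇ 0) ⟩
    (if lookupD e b ≡ᵇ 0 then 0ℤ else (if lookupD e a ≡ᵇ 0 then 0ℤ else coeffMul E k (decAt a (decAt b e))))
  ≡⟨ cong (λ p → if lookupD e b ≡ᵇ 0 then 0ℤ else (if p ≡ᵇ 0 then 0ℤ else coeffMul E k (decAt a (decAt b e))))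
       (sym (lookupD-decAt-other b a e a≢b)) ⟩
    (if lookupD e b ≡ᵇ 0 then 0ℤ else (if lookupD (decAt b e) a ≡ᵇ 0 then 0ℤ else coeffMul E k (decAt a (decAt b e))))
  ∎
  where
  open ≡-Reasoning
  if-swap : ∀ {x} (p q : Bool) → (if p then 0ℤ else (if q then 0ℤ else x)) ≡ (if q then 0ℤ else (if p then 0ℤ else x))
  if-swap true  true  = refl
  if-swap true  false = refl
  if-swap false true  = refl
  if-swap false false = refl

coeffMul-swap : ∀ x y E k e → coeffMul (x ∷ y ∷ E) k e ≡ coeffMul (y ∷ x ∷ E) k e
coeffMul-swap (u₁ , v₁) (u₂ , v₂) E k e =
  begin
    coeffMul ((u₁ , v₁) ∷ (u₂ , v₂) ∷ E) k e
  ≡⟨ expand u₁ v₁ u₂ v₂ ⟩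
    (c u₁ u₂ -ℤ c u₁ v₂) -ℤ (c v₁ u₂ -ℤ c v₁ v₂)
  ≡⟨ regroup (c u₁ u₂) (c u₁ v₂) (c v₁ u₂) (c v₁ v₂) ⟩
    (c u₁ u₂ -ℤ c v₁ u₂) -ℤ (c u₁ v₂ -ℤ c v₁ v₂)
  ≡⟨ cong₂ _-ℤ_ (cong₂ _-ℤ_ (choose₂-comm E k e u₁ u₂) (choose₂-comm E k e v₁ u₂))
                (cong₂ _-ℤ_ (choose₂-comm E k e u₁ v₂) (choose₂-comm E k e v₁ v₂)) ⟩
    (c u₂ u₁ -ℤ c u₂ v₁) -ℤ (c v₂ u₁ -ℤ c v₂ v₁)
  ≡⟨ sym (expand u₂ v₂ u₁ v₁) ⟩
    coeffMul ((u₂ , v₂) ∷ (u₁ , v₁) ∷ E) k e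
  ∎
  where
  open ≡-Reasoning
  c : ℕ → ℕ → ℤ
  c = choose₂ E k e
  if-distrib : ∀ (b : Bool) p q → (if b then 0ℤ else (p -ℤ q)) ≡ (if b then 0ℤ else p) -ℤ (if b then 0ℤ else q)
  if-distrib true  p q = refl
  if-distrib false p q = refl
  expand : ∀ a b a′ b′ → coeffMul ((a , b) ∷ (a′ , b′) ∷ E) k e ≡ (c a a′ -ℤ c a b′) -ℤ (c b a′ -ℤ c b b′)
  expand a b a′ b′ = cong₂ _-ℤ_ (if-distrib (lookupD e a ≡ᵇ 0) _ _) (if-distrib (lookupD e b ≡ᵇ 0) _ _)
  regroup : ∀ p q r s → (p -ℤ q) -ℤ (r -ℤ s) ≡ (p -ℤ r) -ℤ (q -ℤ s)
  regroup = solve 4 (λ p q r s → (p :- q) :- (r :- s) := (p :- r) :- (q :- s)) refl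
    where open +-*-Solver

coeffMul-∷-cong : ∀ x L L′ k → (∀ e → coeffMul L k e ≡ coeffMul L′ k e) →
  ∀ e → coeffMul (x ∷ L) k e ≡ coeffMul (x ∷ L′) k e
coeffMul-∷-cong (u , v) L L′ k L≡L′ e = cong₂ _-ℤ_ (branch u) (branch v)
  where
  branch : ∀ w → choose L k e w ≡ choose L′ k e w
  branch w with lookupD e w ≡ᵇ 0
  ... | true  = refl
  ... | false = L≡L′ (decAt w e)

coeffMul-move-front : ∀ A x B k e → coeffMul (A ++ x ∷ B) k e ≡ coeffMul (x ∷ A ++ B) k e
coeffMul-move-front []      x B k e = refl
coeffMul-move-front (y ∷ A) x B k e =
  trans (coeffMul-∷-cong y (A ++ x ∷ B) (x ∷ A ++ B) k (coeffMul-move-front A x B k) e)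
        (coeffMul-swap y x (A ++ B) k e)

coeffMul-take-first : ∀ u v R k f {n} → lookupD f u ≡ suc n → choose R k f v ≡ 0ℤ →
  coeffMul ((u , v) ∷ R) k f ≡ coeffMul R k (decAt u f)
coeffMul-take-first u v R k f fu≡1+n v-dead rewrite choose-suc R k f u fu≡1+n | v-dead = ℤ.+-identityʳ _

coeffMul-take-second : ∀ u v R k f {n} → lookupD f v ≡ suc n → choose R k f u ≡ 0ℤ →
  coeffMul ((u , v) ∷ R) k f ≡ - coeffMul R k (decAt v f)
coeffMul-take-second u v R k f fv≡1+n u-dead rewrite choose-suc R k f v fv≡1+n | u-dead = ℤ.+-identityˡ _

-- The edges at v₁

degV₁-edge : ℕ → ℕ → ℕ → ℕ
degV₁-edge u v y = if u ≡ᵇ 0 then [ v ↦ 1 ] y else (if v ≡ᵇ 0 then [ u ↦ 1 ] y else 0)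

degV₁ : List Edge → ℕ → ℕ
degV₁ []            y = 0
degV₁ ((u , v) ∷ E) y = degV₁-edge u v y + degV₁ E y

withoutV₁ : List Edge → List Edge
withoutV₁ []            = []
withoutV₁ ((u , v) ∷ E) = if (u ≡ᵇ 0) ∨ (v ≡ᵇ 0) then withoutV₁ E else (u , v) ∷ withoutV₁ E

signV₁ : List Edge → ℤ
signV₁ []            = 1ℤ
signV₁ ((u , v) ∷ E) = if u ≡ᵇ 0 then - signV₁ E else signV₁ E

∣signV₁∣≡1 : ∀ E → ∣ signV₁ E ∣ ≡ 1
∣signV₁∣≡1 []            = refl
∣signV₁∣≡1 ((u , v) ∷ E) with u ≡ᵇ 0
... | true  = trans (ℤ.∣-i∣≡∣i∣ (signV₁ E)) (∣signV₁∣≡1 E)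
... | false = ∣signV₁∣≡1 E

decAt-lowers-< : ∀ x e y d → lookupD e x ≢ 0 → lookupD e y < [ x ↦ 1 ] y + d → lookupD (decAt x e) y < d
decAt-lowers-< x e y d ex≢0 ey<1+d with y ≟ x
... | yes refl rewrite ≡ᵇ-refl y = subst (_< d) (sym (lookupD-decAt-same y e)) (∸1-< ex≢0 (≤-pred ey<1+d))
... | no y≢x rewrite ≢⇒≡ᵇ-false (y≢x ∘ sym) = subst (_< d) (sym (lookupD-decAt-other x y e y≢x)) ey<1+d

coeffMul-deficient : ∀ E k e y → lookupD e 0 ≡ 0 → lookupD e y < degV₁ E y → coeffMul E k e ≡ 0ℤ
coeffMul-deficient [] k e y e0≡0 ()
coeffMul-deficient ((zero , v) ∷ E) k e y e0≡0 ey<deg =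
  cong₂ _-ℤ_ (choose-vanish E k e 0 (⊥-elim ∘ (_$ e0≡0))) (choose-vanish E k e v λ ev≢0 →
    coeffMul-deficient E k (decAt v e) y (decAt-preserves-0 v e e0≡0) (decAt-lowers-< v e y _ ev≢0 ey<deg))
coeffMul-deficient ((suc u , zero) ∷ E) k e y e0≡0 ey<deg =
  cong₂ _-ℤ_ (choose-vanish E k e (suc u) λ eu≢0 →
    coeffMul-deficient E k (decAt (suc u) e) y (decAt-preserves-0 (suc u) e e0≡0) (decAt-lowers-< (suc u) e y _ eu≢0 ey<deg))
    (choose-vanish E k e 0 (⊥-elim ∘ (_$ e0≡0)))
coeffMul-deficient ((suc u , suc v) ∷ E) k e y e0≡0 ey<deg = cong₂ _-ℤ_ (unforced (suc u)) (unforced (suc v))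
  where
  unforced : ∀ x → choose E k e x ≡ 0ℤ
  unforced x = choose-vanish E k e x λ _ →
    coeffMul-deficient E k (decAt x e) y (decAt-preserves-0 x e e0≡0) (≤-<-trans (lookupD-decAt-≤ x e y) ey<deg)

∸-comm-1 : ∀ a d → (a ∸ d) ∸ 1 ≡ (a ∸ 1) ∸ d
∸-comm-1 a d = trans (∸-+-assoc a d 1) (trans (cong (a ∸_) (+-comm d 1)) (sym (∸-+-assoc a 1 d)))

module _ (w : ℕ) (e : List ℕ) (d : ℕ → ℕ) where

  decAt-≥ : ∀ y → [ w ↦ 1 ] y + d y ≤ lookupD e y → d y ≤ lookupD (decAt w e) y
  decAt-≥ y h with y ≟ w
  ... | yes refl rewrite ≡ᵇ-refl y | lookupD-decAt-same y e with lookupD e y | h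
  ...   | suc a | s≤s d≤a = d≤a
  decAt-≥ y h | no y≢w rewrite ≢⇒≡ᵇ-false (y≢w ∘ sym) = subst (d y ≤_) (sym (lookupD-decAt-other w y e y≢w)) h

  decAt-∸ : ∀ y → lookupD e y ∸ ([ w ↦ 1 ] y + d y) ≡ lookupD (decAt w e) y ∸ d y
  decAt-∸ y with y ≟ w
  ... | yes refl rewrite ≡ᵇ-refl y = trans (sym (∸-+-assoc (lookupD e y) 1 (d y))) (cong (_∸ d y) (sym (lookupD-decAt-same y e)))
  ... | no y≢w rewrite ≢⇒≡ᵇ-false (y≢w ∘ sym) = cong (_∸ d y) (sym (lookupD-decAt-other w y e y≢w))

  decAt-∸-comm : ∀ e′ → (∀ y → lookupD e′ y ≡ lookupD e y ∸ d y) →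
    ∀ y → lookupD (decAt w e′) y ≡ lookupD (decAt w e) y ∸ d y
  decAt-∸-comm e′ e′≡ y with y ≟ w
  ... | yes refl = trans (lookupD-decAt-same y e′) (trans (cong (_∸ 1) (e′≡ y))
                     (trans (∸-comm-1 (lookupD e y) (d y)) (cong (_∸ d y) (sym (lookupD-decAt-same y e)))))
  ... | no y≢w = trans (lookupD-decAt-other w y e′ y≢w) (trans (e′≡ y) (cong (_∸ d y) (sym (lookupD-decAt-other w y e y≢w))))

-- With v₁ of exponent 0, each edge v₁y must take y: the coefficient is that of the graph without v₁,
-- at the exponent lowered by the v₁-degrees, up to the sign of the edges oriented away from v₁.
coeffMul-withoutV₁ : ∀ E k → Congruent k → ∀ e e′ → lookupD e 0 ≡ 0 →
  (∀ y → degV₁ E y ≤ lookupD e y) → (∀ y → lookupD e′ y ≡ lookupD e y ∸ degV₁ E y) →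
  coeffMul E k e ≡ signV₁ E *ℤ coeffMul (withoutV₁ E) k e′

forcedV₁ : ∀ E k → Congruent k → ∀ e e′ w → lookupD e 0 ≡ 0 →
  (∀ y → [ w ↦ 1 ] y + degV₁ E y ≤ lookupD e y) → (∀ y → lookupD e′ y ≡ lookupD e y ∸ ([ w ↦ 1 ] y + degV₁ E y)) →
  choose E k e w ≡ signV₁ E *ℤ coeffMul (withoutV₁ E) k e′
forcedV₁ E k k-cong e e′ w e0≡0 deg≤e e′≡ =
  trans (choose-suc E k e w (sym (suc[a∸1]≡a ew≢0)))
    (coeffMul-withoutV₁ E k k-cong (decAt w e) e′ (decAt-preserves-0 w e e0≡0)
      (λ y → decAt-≥ w e (degV₁ E) y (deg≤e y)) (λ y → trans (e′≡ y) (decAt-∸ w e (degV₁ E) y)))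
  where
  ew≢0 : lookupD e w ≢ 0
  ew≢0 ew≡0 = n≮0 (subst (suc (degV₁ E w) ≤_) ew≡0 (subst (λ b → b + degV₁ E w ≤ lookupD e w) (↦-here w 1) (deg≤e w)))

coeffMul-withoutV₁ [] k k-cong e e′ e0≡0 deg≤e e′≡ =
  trans (k-cong e e′ (sym ∘ e′≡)) (sym (ℤ.*-identityˡ _))
coeffMul-withoutV₁ ((zero , zero) ∷ E) k k-cong e e′ e0≡0 deg≤e e′≡ =
  ⊥-elim (n≮0 (subst (_ ≤_) e0≡0 (deg≤e 0)))
coeffMul-withoutV₁ ((zero , suc v) ∷ E) k k-cong e e′ e0≡0 deg≤e e′≡ =
  begin
    choose E k e 0 -ℤ choose E k e (suc v)
  ≡⟨ cong₂ _-ℤ_ (choose-vanish E k e 0 (⊥-elim ∘ (_$ e0≡0))) (forcedV₁ E k k-cong e e′ (suc v) e0≡0 deg≤e e′≡) ⟩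
    0ℤ -ℤ (signV₁ E *ℤ coeffMul (withoutV₁ E) k e′)
  ≡⟨ ℤ.+-identityˡ _ ⟩
    - (signV₁ E *ℤ coeffMul (withoutV₁ E) k e′)
  ≡⟨ ℤ.neg-distribˡ-* (signV₁ E) _ ⟩
    (- signV₁ E) *ℤ coeffMul (withoutV₁ E) k e′
  ∎
  where open ≡-Reasoning
coeffMul-withoutV₁ ((suc u , zero) ∷ E) k k-cong e e′ e0≡0 deg≤e e′≡ =
  trans (cong₂ _-ℤ_ (forcedV₁ E k k-cong e e′ (suc u) e0≡0 deg≤e e′≡) (choose-vanish E k e 0 (⊥-elim ∘ (_$ e0≡0))))
        (ℤ.+-identityʳ _)
coeffMul-withoutV₁ ((suc u , suc v) ∷ E) k k-cong e e′ e0≡0 deg≤e e′≡ =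
  trans (cong₂ _-ℤ_ (free (suc u)) (free (suc v))) (*-distribˡ-sub (signV₁ E) _ _)
  where
  *-distribˡ-sub : ∀ a b c → a *ℤ b -ℤ a *ℤ c ≡ a *ℤ (b -ℤ c)
  *-distribˡ-sub a b c = trans (cong (a *ℤ b +ℤ_) (ℤ.neg-distribʳ-* a c)) (sym (ℤ.*-distribˡ-+ a b (- c)))
  free : ∀ x → choose E k e x ≡ signV₁ E *ℤ choose (withoutV₁ E) k e′ x
  free x with lookupD e′ x in e′x≡
  ... | zero = trans (choose-vanish E k e x λ ex≢0 → coeffMul-deficient E k (decAt x e) x (decAt-preserves-0 x e e0≡0)
                       (subst (_< degV₁ E x) (sym (lookupD-decAt-same x e))
                         (∸1-< ex≢0 (m∸n≡0⇒m≤n (trans (sym (e′≡ x)) e′x≡)))))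
                     (sym (ℤ.*-zeroʳ (signV₁ E)))
  ... | suc n = trans (choose-suc E k e x (sym (suc[a∸1]≡a ex≢0)))
                  (coeffMul-withoutV₁ E k k-cong (decAt x e) (decAt x e′) (decAt-preserves-0 x e e0≡0)
                    (λ y → decAt-≥ x e (degV₁ E) y (deg≤e′ y)) (decAt-∸-comm x e (degV₁ E) e′ e′≡))
    where
    ex≢0 : lookupD e x ≢ 0
    ex≢0 ex≡0 = 1+n≢0 (trans (sym e′x≡) (trans (e′≡ x) (trans (cong (_∸ degV₁ E x) ex≡0) (0∸n≡0 (degV₁ E x)))))
    deg≤e′ : ∀ y → [ x ↦ 1 ] y + degV₁ E y ≤ lookupD e y
    deg≤e′ y with x ≟ y
    ... | yes refl rewrite ≡ᵇ-refl x = m∸n≢0⇒n<m λ e∸d≡0 → 1+n≢0 (trans (sym e′x≡) (trans (e′≡ x) e∸d≡0))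
    ... | no x≢y rewrite ≢⇒≡ᵇ-false x≢y = deg≤e y

coeff-withoutV₁ : ∀ E e e′ → lookupD e 0 ≡ 0 → (∀ y → degV₁ E y ≤ lookupD e y) →
  (∀ y → lookupD e′ y ≡ lookupD e y ∸ degV₁ E y) → coeff E e ≡ signV₁ E *ℤ coeff (withoutV₁ E) e′
coeff-withoutV₁ E e e′ e0≡0 deg≤e e′≡ =
  trans (coeff≡coeffMul-one E e) (trans (coeffMul-withoutV₁ E one one-congruent e e′ e0≡0 deg≤e e′≡)
    (cong (signV₁ E *ℤ_) (sym (coeff≡coeffMul-one (withoutV₁ E) e′))))

-- What is left of f once a block has used up the whole exponent on its zone Z and β at its last vertex t.
record Residual (Z : ℕ → Set) (t β : ℕ) (f F : List ℕ) : Set where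
  field
    zeroed    : ∀ y → Z y → lookupD F y ≡ 0
    atEnd     : lookupD F t + β ≡ lookupD f t
    elsewhere : ∀ y → ¬ Z y → y ≢ t → lookupD F y ≡ lookupD f y

open Residual public

residual-refl : ∀ {Z : ℕ → Set} {t F} → (∀ y → Z y → lookupD F y ≡ 0) → Residual Z t 0 F F
residual-refl F≡0 = record { zeroed = F≡0 ; atEnd = +-identityʳ _ ; elsewhere = λ _ _ _ → refl }

residual-decAt : ∀ {Z : ℕ → Set} {t β f F w} → Z w → ¬ Z t → Residual Z t β (decAt w f) F → Residual Z t β f F
residual-decAt {Z} {t} {f = f} {w = w} Zw ¬Zt r = record
  { zeroed    = zeroed r
  ; atEnd     = trans (atEnd r) (lookupD-decAt-other w t f (λ t≡w → ¬Zt (subst Z (sym t≡w) Zw)))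
  ; elsewhere = λ y ¬Zy y≢t → trans (elsewhere r y ¬Zy y≢t) (lookupD-decAt-other w y f (λ y≡w → ¬Zy (subst Z (sym y≡w) Zw)))
  }

residual-decAt-end : ∀ {Z : ℕ → Set} {t β f F} → 1 ≤ lookupD f t → Residual Z t β (decAt t f) F → Residual Z t (suc β) f F
residual-decAt-end {t = t} {β} {f} {F} 1≤ft r = record
  { zeroed    = zeroed r
  ; atEnd     = trans (+-suc (lookupD F t) β) (trans (cong suc (trans (atEnd r) (lookupD-decAt-same t f)))
                  (suc[a∸1]≡a (λ ft≡0 → n≮0 (subst (1 ≤_) ft≡0 1≤ft))))
  ; elsewhere = λ y ¬Zy y≢t → trans (elsewhere r y ¬Zy y≢t) (lookupD-decAt-other t y f y≢t)
  }

residual-extend : ∀ {Z Z′ : ℕ → Set} {t β f f₁ F} → (∀ y → Z′ y → Z y) → ¬ Z t →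
  (∀ y → Z y → Z′ y ⊎ (¬ Z′ y × lookupD f₁ y ≡ 0)) → (∀ y → ¬ Z y → lookupD f₁ y ≡ lookupD f y) →
  Residual Z′ t β f₁ F → Residual Z t β f F
residual-extend {Z} {Z′} {t} {f₁ = f₁} {F} Z′⊆Z ¬Zt split same r = record
  { zeroed = zeroed′ ; atEnd = trans (atEnd r) (same t ¬Zt)
  ; elsewhere = λ y ¬Zy y≢t → trans (elsewhere r y (¬Zy ∘ Z′⊆Z y) y≢t) (same y ¬Zy) }
  where
  zeroed′ : ∀ y → Z y → lookupD F y ≡ 0
  zeroed′ y Zy with split y Zy
  ... | inj₁ Z′y           = zeroed r y Z′y
  ... | inj₂ (¬Z′y , f₁y≡0) = trans (elsewhere r y ¬Z′y (λ y≡t → ¬Zt (subst Z y≡t Zy))) f₁y≡0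

residual-unique : ∀ {Z : ℕ → Set} {t β f F₁ F₂} → (∀ y → Dec (Z y)) → ¬ Z t →
  Residual Z t β f F₁ → Residual Z t β f F₂ → F₁ ≐ F₂
residual-unique {t = t} Z? ¬Zt r₁ r₂ y with Z? y
... | yes Zy = trans (zeroed r₁ y Zy) (sym (zeroed r₂ y Zy))
... | no ¬Zy with y ≟ t
...   | yes refl = +-cancelʳ-≡ _ _ _ (trans (atEnd r₁) (sym (atEnd r₂)))
...   | no y≢t   = trans (elsewhere r₁ y ¬Zy y≢t) (sym (elsewhere r₂ y ¬Zy y≢t))

residual-of-sum : ∀ {Z : ℕ → Set} {t β f F} (B R : ℕ → ℕ) → (∀ y → Dec (Z y)) → Residual Z t β f F →
  (∀ y → lookupD f y ≡ B y + R y) → (∀ y → Z y → R y ≡ 0) → B t ≡ β →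
  (∀ y → ¬ Z y → y ≢ t → B y ≡ 0) → ∀ y → lookupD F y ≡ R y
residual-of-sum {t = t} {β} B R Z? r f≡B+R R≡0 Bt≡β B≡0 y with Z? y
... | yes Zy = trans (zeroed r y Zy) (sym (R≡0 y Zy))
... | no ¬Zy with y ≟ t
...   | yes refl = +-cancelʳ-≡ β _ _ (trans (atEnd r) (trans (f≡B+R y) (trans (cong (_+ R y) Bt≡β) (+-comm β (R y)))))
...   | no y≢t   = trans (elsewhere r y ¬Zy y≢t) (trans (f≡B+R y) (cong (_+ R y) (B≡0 y ¬Zy y≢t)))

-- Path blocks

data PathSplit : ℕ → ℕ → Set where
  takeStart : PathSplit 1 0
  takeEnd   : PathSplit 0 1

PathResult : ℕ → ℕ → ℕ → CoeffFn → List ℕ → ℕ → Set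
PathResult m s t k f β = ∃[ F ] (Residual (Between s t) t β f F ×
  ∃[ σ ] (∣ σ ∣ ≡ 1 × coeffMul (pathEdges s (suc m)) k f ≡ σ *ℤ k F))

residual-Between-step : ∀ {s t β f w F} → Between s t w → lookupD (decAt w f) s ≡ 0 →
  Residual (Between (suc s) t) t β (decAt w f) F → Residual (Between s t) t β f F
residual-Between-step {s} {t} {f = f} {w} w∈ s-spent r =
  residual-extend (λ _ (s<y , y<t) → <⇒≤ s<y , y<t) (<-irrefl refl ∘ proj₂) split same r
  where
  split : ∀ y → Between s t y → Between (suc s) t y ⊎ (¬ Between (suc s) t y × lookupD (decAt w f) y ≡ 0)
  split y (s≤y , y<t) with y ≟ s
  ... | yes refl = inj₂ ((<-irrefl refl ∘ proj₁) , s-spent)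
  ... | no y≢s   = inj₁ (≤∧≢⇒< s≤y (y≢s ∘ sym) , y<t)
  same : ∀ y → ¬ Between s t y → lookupD (decAt w f) y ≡ lookupD f y
  same y y∉ = lookupD-decAt-other w y f (λ y≡w → y∉ (subst (Between s t) (sym y≡w) w∈))

-- A path s … t whose inner vertices have exponent 1: the one spare unit sits at s or is taken from t.
pathBlock : ∀ m s t k f {A β} → PathSplit A β → suc (s + m) ≡ t → lookupD f s ≡ A →
  (∀ y → s < y → y < t → lookupD f y ≡ 1) → β ≤ lookupD f t → VanishesOn (Between s t) k → PathResult m s t k f β
pathBlock zero s t k f split t≡ fs≡A inner≡1 β≤ft k-van with trans (cong suc (sym (+-identityʳ s))) t≡
pathBlock zero s .(suc s) k f takeStart t≡ fs≡1 inner≡1 β≤ft k-van | refl =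
  decAt s f , residual , 1ℤ , refl ,
  trans (coeffMul-take-first s (suc s) [] k f fs≡1 (choose-vanish [] k f (suc s) λ _ →
          k-van s (≤-refl , ≤-refl) _ (0<-of (trans (lookupD-decAt-other (suc s) s f (<⇒≢ ≤-refl)) fs≡1))))
        (sym (ℤ.*-identityˡ _))
  where
  residual : Residual (Between s (suc s)) (suc s) 0 f (decAt s f)
  residual = residual-decAt (≤-refl , ≤-refl) (<-irrefl refl ∘ proj₂) (residual-refl λ y y∈ →
    subst (λ x → lookupD (decAt s f) x ≡ 0) (sym (Between-single y∈)) (trans (lookupD-decAt-same s f) (cong (_∸ 1) fs≡1)))
pathBlock zero s .(suc s) k f takeEnd t≡ fs≡0 inner≡1 1≤ft k-van | refl =
  decAt (suc s) f , residual , -1ℤ , refl ,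
  trans (coeffMul-take-second s (suc s) [] k f (sym (suc[a∸1]≡a ft≢0)) (choose-zero [] k f s fs≡0)) (sym (ℤ.-1*i≡-i _))
  where
  ft≢0 : lookupD f (suc s) ≢ 0
  ft≢0 ft≡0 = n≮0 (subst (0 <_) ft≡0 1≤ft)
  residual : Residual (Between s (suc s)) (suc s) 1 f (decAt (suc s) f)
  residual = residual-decAt-end 1≤ft (residual-refl λ y y∈ →
    subst (λ x → lookupD (decAt (suc s) f) x ≡ 0) (sym (Between-single y∈))
      (trans (lookupD-decAt-other (suc s) s f (<⇒≢ ≤-refl)) fs≡0))
pathBlock (suc m) s t k f {β = β} split t≡ fs≡A inner≡1 β≤ft k-van = step split fs≡A
  where
  R = pathEdges (suc s) (suc m)
  t≡′ : suc (suc s + m) ≡ t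
  t≡′ = trans (cong suc (sym (+-suc s m))) t≡
  1+s<t : suc s < t
  1+s<t = subst (suc s <_) t≡ (s≤s (subst (suc s ≤_) (sym (+-suc s m)) (s≤s (m≤m+n s m))))
  f1+s≡1 : lookupD f (suc s) ≡ 1
  f1+s≡1 = inner≡1 (suc s) ≤-refl 1+s<t
  recurse : ∀ {A} → PathSplit A β → ∀ w → w ≤ suc s → lookupD (decAt w f) (suc s) ≡ A → PathResult m (suc s) t k (decAt w f) β
  recurse split′ w w≤1+s g1+s≡A = pathBlock m (suc s) t k (decAt w f) split′ t≡′ g1+s≡A
    (λ y 1+s<y y<t → trans (lookupD-decAt-other w y f (λ y≡w → <⇒≢ (≤-<-trans w≤1+s 1+s<y) (sym y≡w)))
                           (inner≡1 y (<⇒≤ 1+s<y) y<t))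
    (subst (β ≤_) (sym (lookupD-decAt-other w t f (λ t≡w → <⇒≢ (≤-<-trans w≤1+s 1+s<t) (sym t≡w)))) β≤ft)
    (λ y (1+s≤y , y<t) → k-van y (<⇒≤ 1+s≤y , y<t))
  step : ∀ {A} → PathSplit A β → lookupD f s ≡ A → PathResult (suc m) s t k f β
  step takeStart fs≡1 with recurse takeStart s (n≤1+n s) (trans (lookupD-decAt-other s (suc s) f (<⇒≢ ≤-refl ∘ sym)) f1+s≡1)
  ... | F , r , σ , ∣σ∣≡1 , eq = F , residual-Between-step (≤-refl , <-trans ≤-refl 1+s<t)
        (trans (lookupD-decAt-same s f) (cong (_∸ 1) fs≡1)) r , σ , ∣σ∣≡1 ,
    trans (coeffMul-take-first s (suc s) R k f fs≡1 (choose-vanish R k f (suc s) λ _ →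
             coeffMul-vanish R k (avoids-pathEdges (inj₁ ≤-refl)) (k-van s (≤-refl , <-trans ≤-refl 1+s<t)) (decAt (suc s) f)
               (0<-of (trans (lookupD-decAt-other (suc s) s f (<⇒≢ ≤-refl)) fs≡1))))
          eq
  step takeEnd fs≡0 with recurse takeEnd (suc s) ≤-refl (trans (lookupD-decAt-same (suc s) f) (cong (_∸ 1) f1+s≡1))
  ... | F , r , σ , ∣σ∣≡1 , eq = F , residual-Between-step (n≤1+n s , 1+s<t)
        (trans (lookupD-decAt-other (suc s) s f (<⇒≢ ≤-refl)) fs≡0) r , - σ , trans (ℤ.∣-i∣≡∣i∣ σ) ∣σ∣≡1 ,
    trans (coeffMul-take-second s (suc s) R k f f1+s≡1 (choose-zero R k f s fs≡0))
          (trans (cong -_ eq) (ℤ.neg-distribˡ-* σ _))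

-- Fan blocks

edge-take-centre : ∀ c t k g → t ≢ c → lookupD g c ≡ 1 → VanishesAt c k → coeffMul ((c , t) ∷ []) k g ≡ k (decAt c g)
edge-take-centre c t k g t≢c gc≡1 k-van = coeffMul-take-first c t [] k g gc≡1
  (choose-vanish [] k g t λ _ → k-van (decAt t g) (0<-of (trans (lookupD-decAt-other t c g (t≢c ∘ sym)) gc≡1)))

edge-take-end : ∀ c t k g {n} → lookupD g c ≡ 0 → lookupD g t ≡ suc n → coeffMul ((c , t) ∷ []) k g ≡ - k (decAt t g)
edge-take-end c t k g gc≡0 gt≡1+n = coeffMul-take-second c t [] k g gt≡1+n (choose-zero [] k g c gc≡0)

edge-overloaded : ∀ c t k g {n} → t ≢ c → lookupD g c ≡ suc (suc n) → VanishesAt c k → coeffMul ((c , t) ∷ []) k g ≡ 0ℤ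
edge-overloaded c t k g t≢c gc≡2+n k-van = cong₂ _-ℤ_
  (choose-vanish [] k g c λ _ → k-van (decAt c g) (0<-of (trans (lookupD-decAt-same c g) (cong (_∸ 1) gc≡2+n))))
  (choose-vanish [] k g t λ _ → k-van (decAt t g) (0<-of (trans (lookupD-decAt-other t c g (t≢c ∘ sym)) gc≡2+n)))

fanStart₀ : ∀ c s R k f {γ n} → c ≢ s → c ≢ suc s → lookupD f s ≡ 0 → lookupD f c ≡ suc γ → lookupD f (suc s) ≡ suc n →
  coeffMul ((c , s) ∷ (s , suc s) ∷ R) k f ≡ - coeffMul R k (decAt (suc s) (decAt c f))
fanStart₀ c s R k f c≢s c≢1+s fs≡0 fc≡1+γ f1+s≡1+n =
  trans (coeffMul-take-first c s ((s , suc s) ∷ R) k f fc≡1+γ (choose-zero ((s , suc s) ∷ R) k f s fs≡0))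
    (coeffMul-take-second s (suc s) R k (decAt c f) (trans (lookupD-decAt-other c (suc s) f (c≢1+s ∘ sym)) f1+s≡1+n)
      (choose-zero R k (decAt c f) s (trans (lookupD-decAt-other c s f (c≢s ∘ sym)) fs≡0)))

fanStart₁ : ∀ c s R k f {γ} → c ≢ s → lookupD f s ≡ 1 → lookupD f c ≡ suc γ → Avoids s R → VanishesAt s k →
  coeffMul ((c , s) ∷ (s , suc s) ∷ R) k f ≡ coeffMul R k (decAt s (decAt c f)) +ℤ choose R k (decAt s f) (suc s)
fanStart₁ c s R k f c≢s fs≡1 fc≡1+γ avoids k-van =
  begin
    choose ((s , suc s) ∷ R) k f c -ℤ choose ((s , suc s) ∷ R) k f s
  ≡⟨ cong₂ _-ℤ_ (choose-suc ((s , suc s) ∷ R) k f c fc≡1+γ) (choose-suc ((s , suc s) ∷ R) k f s fs≡1) ⟩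
    coeffMul ((s , suc s) ∷ R) k (decAt c f) -ℤ coeffMul ((s , suc s) ∷ R) k (decAt s f)
  ≡⟨ cong₂ _-ℤ_ (coeffMul-take-first s (suc s) R k (decAt c f) gs≡1 (choose-vanish R k (decAt c f) (suc s) λ _ →
                   coeffMul-vanish R k avoids k-van (decAt (suc s) (decAt c f))
                     (0<-of (trans (lookupD-decAt-other (suc s) s (decAt c f) (<⇒≢ ≤-refl)) gs≡1))))
                (cong (_-ℤ choose R k (decAt s f) (suc s))
                   (choose-zero R k (decAt s f) s (trans (lookupD-decAt-same s f) (cong (_∸ 1) fs≡1)))) ⟩
    coeffMul R k (decAt s (decAt c f)) -ℤ (0ℤ -ℤ choose R k (decAt s f) (suc s))
  ≡⟨ cong (coeffMul R k (decAt s (decAt c f)) +ℤ_) (trans (cong -_ (ℤ.+-identityˡ _)) (ℤ.neg-involutive _)) ⟩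
    coeffMul R k (decAt s (decAt c f)) +ℤ choose R k (decAt s f) (suc s)
  ∎
  where
  open ≡-Reasoning
  gs≡1 : lookupD (decAt c f) s ≡ 1
  gs≡1 = trans (lookupD-decAt-other c s f (c≢s ∘ sym)) fs≡1

fanStart₂ : ∀ c s R k f → c ≢ s → lookupD f s ≡ 2 → Avoids s R → VanishesAt s k →
  coeffMul ((c , s) ∷ (s , suc s) ∷ R) k f ≡ - coeffMul R k (decAt s (decAt s f))
fanStart₂ c s R k f c≢s fs≡2 avoids k-van =
  begin
    choose ((s , suc s) ∷ R) k f c -ℤ choose ((s , suc s) ∷ R) k f s
  ≡⟨ cong₂ _-ℤ_ (choose-vanish ((s , suc s) ∷ R) k f c λ _ → centre-dead)
                (choose-suc ((s , suc s) ∷ R) k f s fs≡2) ⟩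
    0ℤ -ℤ coeffMul ((s , suc s) ∷ R) k (decAt s f)
  ≡⟨ cong (0ℤ -ℤ_) (coeffMul-take-first s (suc s) R k (decAt s f) hs≡1 (choose-vanish R k (decAt s f) (suc s) λ _ →
       dead (decAt (suc s) (decAt s f)) (trans (lookupD-decAt-other (suc s) s (decAt s f) (<⇒≢ ≤-refl)) hs≡1))) ⟩
    0ℤ -ℤ coeffMul R k (decAt s (decAt s f))
  ≡⟨ ℤ.+-identityˡ _ ⟩
    - coeffMul R k (decAt s (decAt s f))
  ∎
  where
  open ≡-Reasoning
  dead : ∀ e {n} → lookupD e s ≡ suc n → coeffMul R k e ≡ 0ℤ
  dead e es≡1+n = coeffMul-vanish R k avoids k-van e (0<-of es≡1+n)
  hs≡1 : lookupD (decAt s f) s ≡ 1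
  hs≡1 = trans (lookupD-decAt-same s f) (cong (_∸ 1) fs≡2)
  gs≡2 : lookupD (decAt c f) s ≡ 2
  gs≡2 = trans (lookupD-decAt-other c s f (c≢s ∘ sym)) fs≡2
  centre-dead : coeffMul ((s , suc s) ∷ R) k (decAt c f) ≡ 0ℤ
  centre-dead = cong₂ _-ℤ_
    (choose-vanish R k (decAt c f) s λ _ → dead (decAt s (decAt c f)) (trans (lookupD-decAt-same s (decAt c f)) (cong (_∸ 1) gs≡2)))
    (choose-vanish R k (decAt c f) (suc s) λ _ → dead (decAt (suc s) (decAt c f))
      (trans (lookupD-decAt-other (suc s) s (decAt c f) (<⇒≢ ≤-refl)) gs≡2))

fanEdges : ℕ → ℕ → ℕ → List Edge
fanEdges c s m = fan c s (suc (suc m)) ++ pathEdges s (suc m)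

fanEdges-reorder : ∀ m s c k f → coeffMul (fanEdges c s m) k f ≡
  coeffMul ((c , s) ∷ (s , suc s) ∷ (fan c (suc s) (suc m) ++ pathEdges (suc s) m)) k f
fanEdges-reorder m s c k = coeffMul-∷-cong (c , s) (fan c (suc s) (suc m) ++ (s , suc s) ∷ pathEdges (suc s) m)
  ((s , suc s) ∷ (fan c (suc s) (suc m) ++ pathEdges (suc s) m)) k
  (coeffMul-move-front (fan c (suc s) (suc m)) (s , suc s) (pathEdges (suc s) m) k)

FanZone : ℕ → ℕ → ℕ → ℕ → Set
FanZone c s t y = y ≡ c ⊎ Between s t y

fanZone? : ∀ c s t y → Dec (FanZone c s t y)
fanZone? c s t y with y ≟ c | between? s t y
... | yes y≡c | _        = yes (inj₁ y≡c)
... | no _    | yes y∈   = yes (inj₂ y∈)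
... | no y≢c  | no y∉    = no λ { (inj₁ y≡c) → y≢c y≡c ; (inj₂ y∈) → y∉ y∈ }

-- The exponents γ, A, β at the centre, the first rim vertex and (taken from) the last rim vertex of a
-- fan block: every inner rim vertex uses up 2, which leaves 3 for these.
data FanSplit : ℕ → ℕ → ℕ → Set where
  split300 : FanSplit 3 0 0
  split201 : FanSplit 2 0 1
  split210 : FanSplit 2 1 0
  split111 : FanSplit 1 1 1
  split120 : FanSplit 1 2 0
  split021 : FanSplit 0 2 1

-- The coefficient of a fan block: the values at m = 0 come from FanBase, the recursion from fanStart₀,₁,₂.
transfer : ℕ → ℕ → ℕ → ℤ
transfer zero    0 1 = -1ℤ
transfer zero    1 0 = 1ℤ
transfer zero    2 0 = -1ℤ
transfer zero    2 1 = 1ℤ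
transfer zero    _ _ = 0ℤ
transfer (suc m) 0 β = - transfer m 1 β
transfer (suc m) 1 β = transfer m 2 β +ℤ transfer m 1 β
transfer (suc m) 2 β = - transfer m 2 β
transfer (suc m) _ _ = 0ℤ

FanResult : ℕ → ℕ → ℕ → ℕ → CoeffFn → List ℕ → ℕ → ℕ → Set
FanResult m s t c k f A β = ∃[ F ] (Residual (FanZone c s t) t β f F × coeffMul (fanEdges c s m) k f ≡ transfer m A β *ℤ k F)

module FanBase (s c : ℕ) (k : CoeffFn) (f : List ℕ) (1+s<c : suc s < c) (k-van : VanishesOn (FanZone c s (suc s)) k) where

  c≢s : c ≢ s
  c≢s c≡s = <⇒≢ (<-trans ≤-refl 1+s<c) (sym c≡s)

  c≢1+s : c ≢ suc s
  c≢1+s c≡1+s = <⇒≢ 1+s<c (sym c≡1+s)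

  Zc : FanZone c s (suc s) c
  Zc = inj₁ refl

  Zs : FanZone c s (suc s) s
  Zs = inj₂ (≤-refl , ≤-refl)

  ¬Zt : ¬ FanZone c s (suc s) (suc s)
  ¬Zt (inj₁ 1+s≡c)     = c≢1+s (sym 1+s≡c)
  ¬Zt (inj₂ (_ , 1+s<1+s)) = <-irrefl refl 1+s<1+s

  zone-zero : ∀ F → lookupD F c ≡ 0 → lookupD F s ≡ 0 → ∀ y → FanZone c s (suc s) y → lookupD F y ≡ 0
  zone-zero F Fc≡0 Fs≡0 y (inj₁ refl) = Fc≡0
  zone-zero F Fc≡0 Fs≡0 y (inj₂ y∈) = subst (λ x → lookupD F x ≡ 0) (sym (Between-single y∈)) Fs≡0

  avoids : Avoids s ((c , suc s) ∷ [])
  avoids = (c≢s , (<⇒≢ ≤-refl ∘ sym)) ∷ []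

  at : ∀ e {a b} → a ≢ b → lookupD (decAt b e) a ≡ lookupD e a
  at e {a} {b} = lookupD-decAt-other b a e

  unpred : ∀ {a} → 1 ≤ a → a ≡ suc (a ∸ 1)
  unpred {suc a} _ = refl

  s≢c : s ≢ c
  s≢c = c≢s ∘ sym

  s≢1+s : s ≢ suc s
  s≢1+s = <⇒≢ ≤-refl

  1+s≢c : suc s ≢ c
  1+s≢c = c≢1+s ∘ sym

  1+s≢s : suc s ≢ s
  1+s≢s = s≢1+s ∘ sym

  base201 : lookupD f c ≡ 2 → lookupD f s ≡ 0 → 1 ≤ lookupD f (suc s) → FanResult 0 s (suc s) c k f 0 1
  base201 fc≡2 fs≡0 1≤ft = F , residual , coefficient
    where
    f₁ = decAt c f
    g = decAt (suc s) f₁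
    F = decAt c g
    gc≡1 : lookupD g c ≡ 1
    gc≡1 = trans (at f₁ c≢1+s) (trans (lookupD-decAt-same c f) (cong (_∸ 1) fc≡2))
    coefficient : coeffMul (fanEdges c s 0) k f ≡ transfer 0 0 1 *ℤ k F
    coefficient = trans (fanEdges-reorder 0 s c k f) (trans (fanStart₀ c s ((c , suc s) ∷ []) k f c≢s c≢1+s fs≡0 fc≡2 (unpred 1≤ft))
      (trans (cong -_ (edge-take-centre c (suc s) k g 1+s≢c gc≡1 (k-van c Zc))) (sym (ℤ.-1*i≡-i _))))
    residual : Residual (FanZone c s (suc s)) (suc s) 1 f F
    residual = residual-decAt Zc ¬Zt (residual-decAt-end (subst (1 ≤_) (sym (at f 1+s≢c)) 1≤ft) (residual-decAt Zc ¬Zt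
      (residual-refl (zone-zero F (trans (lookupD-decAt-same c g) (cong (_∸ 1) gc≡1))
        (trans (at g s≢c) (trans (at f₁ s≢1+s) (trans (at f s≢c) fs≡0)))))))

  base210 : lookupD f c ≡ 2 → lookupD f s ≡ 1 → FanResult 0 s (suc s) c k f 1 0
  base210 fc≡2 fs≡1 = F , residual , coefficient
    where
    f₁ = decAt c f
    g = decAt s f₁
    F = decAt c g
    gc≡1 : lookupD g c ≡ 1
    gc≡1 = trans (at f₁ c≢s) (trans (lookupD-decAt-same c f) (cong (_∸ 1) fc≡2))
    overloaded : coeffMul ((c , suc s) ∷ []) k (decAt (suc s) (decAt s f)) ≡ 0ℤ
    overloaded = edge-overloaded c (suc s) k (decAt (suc s) (decAt s f)) 1+s≢c
      (trans (at (decAt s f) c≢1+s) (trans (at f c≢s) fc≡2)) (k-van c Zc)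
    coefficient : coeffMul (fanEdges c s 0) k f ≡ transfer 0 1 0 *ℤ k F
    coefficient = trans (fanEdges-reorder 0 s c k f) (trans (fanStart₁ c s ((c , suc s) ∷ []) k f c≢s fs≡1 fc≡2 avoids (k-van s Zs))
      (trans (cong₂ _+ℤ_ (edge-take-centre c (suc s) k g 1+s≢c gc≡1 (k-van c Zc))
                         (choose-vanish ((c , suc s) ∷ []) k (decAt s f) (suc s) λ _ → overloaded))
             (trans (ℤ.+-identityʳ _) (sym (ℤ.*-identityˡ _)))))
    residual : Residual (FanZone c s (suc s)) (suc s) 0 f F
    residual = residual-decAt Zc ¬Zt (residual-decAt Zs ¬Zt (residual-decAt Zc ¬Zt
      (residual-refl (zone-zero F (trans (lookupD-decAt-same c g) (cong (_∸ 1) gc≡1))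
        (trans (at g s≢c) (trans (lookupD-decAt-same s f₁) (cong (_∸ 1) (trans (at f s≢c) fs≡1))))))))

  base120 : lookupD f c ≡ 1 → lookupD f s ≡ 2 → FanResult 0 s (suc s) c k f 2 0
  base120 fc≡1 fs≡2 = F , residual , coefficient
    where
    f₁ = decAt s f
    g = decAt s f₁
    F = decAt c g
    gc≡1 : lookupD g c ≡ 1
    gc≡1 = trans (at f₁ c≢s) (trans (at f c≢s) fc≡1)
    coefficient : coeffMul (fanEdges c s 0) k f ≡ transfer 0 2 0 *ℤ k F
    coefficient = trans (fanEdges-reorder 0 s c k f) (trans (fanStart₂ c s ((c , suc s) ∷ []) k f c≢s fs≡2 avoids (k-van s Zs))
      (trans (cong -_ (edge-take-centre c (suc s) k g 1+s≢c gc≡1 (k-van c Zc))) (sym (ℤ.-1*i≡-i _))))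
    residual : Residual (FanZone c s (suc s)) (suc s) 0 f F
    residual = residual-decAt Zs ¬Zt (residual-decAt Zs ¬Zt (residual-decAt Zc ¬Zt
      (residual-refl (zone-zero F (trans (lookupD-decAt-same c g) (cong (_∸ 1) gc≡1))
        (trans (at g s≢c) (trans (lookupD-decAt-same s f₁) (cong (_∸ 1) (trans (lookupD-decAt-same s f) (cong (_∸ 1) fs≡2)))))))))

  base021 : lookupD f c ≡ 0 → lookupD f s ≡ 2 → 1 ≤ lookupD f (suc s) → FanResult 0 s (suc s) c k f 2 1
  base021 fc≡0 fs≡2 1≤ft = F , residual , coefficient
    where
    f₁ = decAt s f
    g = decAt s f₁
    F = decAt (suc s) g
    gt≡ : lookupD g (suc s) ≡ suc (lookupD f (suc s) ∸ 1)
    gt≡ = trans (at f₁ 1+s≢s) (trans (at f 1+s≢s) (unpred 1≤ft))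
    gc≡0 : lookupD g c ≡ 0
    gc≡0 = trans (at f₁ c≢s) (trans (at f c≢s) fc≡0)
    coefficient : coeffMul (fanEdges c s 0) k f ≡ transfer 0 2 1 *ℤ k F
    coefficient = trans (fanEdges-reorder 0 s c k f) (trans (fanStart₂ c s ((c , suc s) ∷ []) k f c≢s fs≡2 avoids (k-van s Zs))
      (trans (cong -_ (edge-take-end c (suc s) k g gc≡0 gt≡)) (trans (ℤ.neg-involutive _) (sym (ℤ.*-identityˡ _)))))
    residual : Residual (FanZone c s (suc s)) (suc s) 1 f F
    residual = residual-decAt Zs ¬Zt (residual-decAt Zs ¬Zt (residual-decAt-end (subst (1 ≤_) (sym gt≡) (s≤s z≤n))
      (residual-refl (zone-zero F (trans (at g c≢1+s) gc≡0)
        (trans (at g s≢1+s) (trans (lookupD-decAt-same s f₁) (cong (_∸ 1) (trans (lookupD-decAt-same s f) (cong (_∸ 1) fs≡2)))))))))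

  base111 : lookupD f c ≡ 1 → lookupD f s ≡ 1 → 1 ≤ lookupD f (suc s) → Congruent k → FanResult 0 s (suc s) c k f 1 1
  base111 fc≡1 fs≡1 1≤ft k-cong = F , residual , coefficient
    where
    X = decAt s (decAt c f)
    F = decAt (suc s) X
    h = decAt (suc s) (decAt s f)
    F′ = decAt c h
    Xc≡0 : lookupD X c ≡ 0
    Xc≡0 = trans (at (decAt c f) c≢s) (trans (lookupD-decAt-same c f) (cong (_∸ 1) fc≡1))
    Xt≡ : lookupD X (suc s) ≡ suc (lookupD f (suc s) ∸ 1)
    Xt≡ = trans (at (decAt c f) 1+s≢s) (trans (at f 1+s≢c) (unpred 1≤ft))
    hc≡1 : lookupD h c ≡ 1
    hc≡1 = trans (at (decAt s f) c≢1+s) (trans (at f c≢s) fc≡1)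
    residual : Residual (FanZone c s (suc s)) (suc s) 1 f F
    residual = residual-decAt Zc ¬Zt (residual-decAt Zs ¬Zt (residual-decAt-end (subst (1 ≤_) (sym Xt≡) (s≤s z≤n))
      (residual-refl (zone-zero F (trans (at X c≢1+s) Xc≡0)
        (trans (at X s≢1+s) (trans (lookupD-decAt-same s (decAt c f)) (cong (_∸ 1) (trans (at f s≢c) fs≡1))))))))
    residual′ : Residual (FanZone c s (suc s)) (suc s) 1 f F′
    residual′ = residual-decAt Zs ¬Zt (residual-decAt-end (subst (1 ≤_) (sym (at f 1+s≢s)) 1≤ft) (residual-decAt Zc ¬Zt
      (residual-refl (zone-zero F′ (trans (lookupD-decAt-same c h) (cong (_∸ 1) hc≡1))
        (trans (at h s≢c) (trans (at (decAt s f) s≢1+s) (trans (lookupD-decAt-same s f) (cong (_∸ 1) fs≡1))))))))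
    kF′≡kF : k F′ ≡ k F
    kF′≡kF = k-cong F′ F (residual-unique (fanZone? c s (suc s)) ¬Zt residual′ residual)
    coefficient : coeffMul (fanEdges c s 0) k f ≡ transfer 0 1 1 *ℤ k F
    coefficient = trans (fanEdges-reorder 0 s c k f) (trans (fanStart₁ c s ((c , suc s) ∷ []) k f c≢s fs≡1 fc≡1 avoids (k-van s Zs))
      (trans (cong₂ _+ℤ_ (edge-take-end c (suc s) k X Xc≡0 Xt≡)
                         (trans (choose-suc ((c , suc s) ∷ []) k (decAt s f) (suc s) (trans (at f 1+s≢s) (unpred 1≤ft)))
                           (trans (edge-take-centre c (suc s) k h 1+s≢c hc≡1 (k-van c Zc)) kF′≡kF)))
             (ℤ.+-inverseˡ (k F))))

  fanBase : ∀ {γ A β} → FanSplit γ A β → γ ≤ 2 → lookupD f c ≡ γ → lookupD f s ≡ A → β ≤ lookupD f (suc s) →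
    Congruent k →
    FanResult 0 s (suc s) c k f A β
  fanBase split300 (s≤s (s≤s ())) fc≡ fs≡ β≤ft k-cong
  fanBase split201 _ fc≡ fs≡ β≤ft k-cong = base201 fc≡ fs≡ β≤ft
  fanBase split210 _ fc≡ fs≡ β≤ft k-cong = base210 fc≡ fs≡
  fanBase split111 _ fc≡ fs≡ β≤ft k-cong = base111 fc≡ fs≡ β≤ft k-cong
  fanBase split120 _ fc≡ fs≡ β≤ft k-cong = base120 fc≡ fs≡
  fanBase split021 _ fc≡ fs≡ β≤ft k-cong = base021 fc≡ fs≡ β≤ft

module FanStep (m s t c : ℕ) (k : CoeffFn) (f : List ℕ) (β : ℕ) (1+s<t : suc s < t) (t<c : t < c)
  (inner≡2 : ∀ y → s < y → y < t → lookupD f y ≡ 2) (β≤ft : β ≤ lookupD f t)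
  (k-van : VanishesOn (FanZone c s t) k) (k-cong : Congruent k)
  (recurse : ∀ g {γ A} → FanSplit γ A β → γ ≤ 2 → lookupD g c ≡ γ → lookupD g (suc s) ≡ A →
    (∀ y → suc s < y → y < t → lookupD g y ≡ 2) → β ≤ lookupD g t → FanResult m (suc s) t c k g A β) where

  s<t : s < t
  s<t = <⇒≤ 1+s<t

  c≢s : c ≢ s
  c≢s c≡s = <⇒≢ (<-trans s<t t<c) (sym c≡s)

  c≢1+s : c ≢ suc s
  c≢1+s c≡1+s = <⇒≢ (<-trans 1+s<t t<c) (sym c≡1+s)

  s≢1+s : s ≢ suc s
  s≢1+s = <⇒≢ ≤-refl

  ¬Zt : ¬ FanZone c s t t
  ¬Zt (inj₁ t≡c)       = <⇒≢ t<c t≡c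
  ¬Zt (inj₂ (_ , t<t)) = <-irrefl refl t<t

  Zc : FanZone c s t c
  Zc = inj₁ refl

  Zs : FanZone c s t s
  Zs = inj₂ (≤-refl , s<t)

  Z1+s : FanZone c s t (suc s)
  Z1+s = inj₂ (n≤1+n s , 1+s<t)

  R : List Edge
  R = fan c (suc s) (suc (suc m)) ++ pathEdges (suc s) (suc m)

  avoids : Avoids s R
  avoids = ++⁺ (avoids-fan {n = suc m} c≢s (inj₁ ≤-refl)) (avoids-pathEdges {n = suc m} (inj₁ ≤-refl))

  f1+s≡2 : lookupD f (suc s) ≡ 2
  f1+s≡2 = inner≡2 (suc s) ≤-refl 1+s<t

  at : ∀ e {a b} → a ≢ b → lookupD (decAt b e) a ≡ lookupD e a
  at e {a} {b} = lookupD-decAt-other b a e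

  widen : ∀ {g F} → lookupD g s ≡ 0 → Residual (FanZone c (suc s) t) t β g F → Residual (FanZone c s t) t β g F
  widen {g} gs≡0 = residual-extend shrink ¬Zt split (λ _ _ → refl)
    where
    shrink : ∀ y → FanZone c (suc s) t y → FanZone c s t y
    shrink y (inj₁ y≡c)           = inj₁ y≡c
    shrink y (inj₂ (1+s≤y , y<t)) = inj₂ (<⇒≤ 1+s≤y , y<t)
    split : ∀ y → FanZone c s t y → FanZone c (suc s) t y ⊎ (¬ FanZone c (suc s) t y × lookupD g y ≡ 0)
    split y (inj₁ y≡c)       = inj₁ (inj₁ y≡c)
    split y (inj₂ (s≤y , y<t)) with y ≟ s
    ... | yes refl = inj₂ ((λ { (inj₁ s≡c) → c≢s (sym s≡c) ; (inj₂ (1+s≤s , _)) → <-irrefl refl 1+s≤s }) , gs≡0)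
    ... | no y≢s   = inj₁ (inj₂ (≤∧≢⇒< s≤y (y≢s ∘ sym) , y<t))

  inner≡2′ : ∀ a b → a ≤ suc s → b ≤ suc s ⊎ b ≡ c → ∀ y → suc s < y → y < t → lookupD (decAt a (decAt b f)) y ≡ 2
  inner≡2′ a b a≤1+s b-near y 1+s<y y<t =
    trans (at (decAt b f) (λ y≡a → <⇒≢ (≤-<-trans a≤1+s 1+s<y) (sym y≡a)))
          (trans (at f (y≢b b-near)) (inner≡2 y (<⇒≤ 1+s<y) y<t))
    where
    y≢b : b ≤ suc s ⊎ b ≡ c → y ≢ b
    y≢b (inj₁ b≤1+s) y≡b = <⇒≢ (≤-<-trans b≤1+s 1+s<y) (sym y≡b)
    y≢b (inj₂ b≡c)   y≡b = <⇒≢ (<-trans y<t t<c) (trans y≡b b≡c)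

  β≤gt : ∀ a b → a ≢ t → b ≢ t → β ≤ lookupD (decAt a (decAt b f)) t
  β≤gt a b a≢t b≢t = subst (β ≤_) (sym (trans (at (decAt b f) (a≢t ∘ sym)) (at f (b≢t ∘ sym)))) β≤ft

  near≢t : ∀ {a} → a ≤ suc s → a ≢ t
  near≢t a≤1+s = <⇒≢ (≤-<-trans a≤1+s 1+s<t)

  c≢t : c ≢ t
  c≢t = <⇒≢ t<c ∘ sym

  step₀ : ∀ {γ} → lookupD f c ≡ suc γ → γ ≤ 2 → FanSplit γ 1 β → lookupD f s ≡ 0 → FanResult (suc m) s t c k f 0 β
  step₀ {γ} fc≡1+γ γ≤2 split fs≡0 =
    extend (recurse g split γ≤2 gc≡γ g1+s≡1 (inner≡2′ (suc s) c ≤-refl (inj₂ refl)) (β≤gt (suc s) c (near≢t ≤-refl) c≢t))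
    where
    g = decAt (suc s) (decAt c f)
    gc≡γ : lookupD g c ≡ γ
    gc≡γ = trans (at (decAt c f) c≢1+s) (trans (lookupD-decAt-same c f) (cong (_∸ 1) fc≡1+γ))
    g1+s≡1 : lookupD g (suc s) ≡ 1
    g1+s≡1 = trans (lookupD-decAt-same (suc s) (decAt c f)) (cong (_∸ 1) (trans (at f (c≢1+s ∘ sym)) f1+s≡2))
    extend : FanResult m (suc s) t c k g 1 β → FanResult (suc m) s t c k f 0 β
    extend (F , r , eq) =
      F , residual-decAt Zc ¬Zt (residual-decAt Z1+s ¬Zt (widen (trans (at (decAt c f) s≢1+s) (trans (at f (c≢s ∘ sym)) fs≡0)) r)) ,
      trans (fanEdges-reorder (suc m) s c k f) (trans (fanStart₀ c s R k f c≢s c≢1+s fs≡0 fc≡1+γ f1+s≡2)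
        (trans (cong -_ eq) (ℤ.neg-distribˡ-* (transfer m 1 β) (k F))))

  step₂ : ∀ {γ} → lookupD f c ≡ γ → γ ≤ 2 → FanSplit γ 2 β → lookupD f s ≡ 2 → FanResult (suc m) s t c k f 2 β
  step₂ {γ} fc≡γ γ≤2 split fs≡2 =
    extend (recurse W split γ≤2 Wc≡γ W1+s≡2 (inner≡2′ s s (n≤1+n s) (inj₁ (n≤1+n s)))
                    (β≤gt s s (near≢t (n≤1+n s)) (near≢t (n≤1+n s))))
    where
    W = decAt s (decAt s f)
    Wc≡γ : lookupD W c ≡ γ
    Wc≡γ = trans (at (decAt s f) c≢s) (trans (at f c≢s) fc≡γ)
    W1+s≡2 : lookupD W (suc s) ≡ 2
    W1+s≡2 = trans (at (decAt s f) (s≢1+s ∘ sym)) (trans (at f (s≢1+s ∘ sym)) f1+s≡2)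
    Ws≡0 : lookupD W s ≡ 0
    Ws≡0 = trans (lookupD-decAt-same s (decAt s f)) (cong (_∸ 1) (trans (lookupD-decAt-same s f) (cong (_∸ 1) fs≡2)))
    extend : FanResult m (suc s) t c k W 2 β → FanResult (suc m) s t c k f 2 β
    extend (F , r , eq) =
      F , residual-decAt Zs ¬Zt (residual-decAt Zs ¬Zt (widen Ws≡0 r)) ,
      trans (fanEdges-reorder (suc m) s c k f) (trans (fanStart₂ c s R k f c≢s fs≡2 avoids (k-van s Zs))
        (trans (cong -_ eq) (ℤ.neg-distribˡ-* (transfer m 2 β) (k F))))

  step₁ : ∀ {γ} → lookupD f c ≡ suc γ → γ ≤ 1 → FanSplit γ 2 β → FanSplit (suc γ) 1 β → lookupD f s ≡ 1 →
    FanResult (suc m) s t c k f 1 β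
  step₁ {γ} fc≡1+γ γ≤1 split₂ split₁ fs≡1 = combine
    (recurse X split₂ (≤-trans γ≤1 (s≤s z≤n)) Xc≡γ X1+s≡2 (inner≡2′ s c (n≤1+n s) (inj₂ refl))
             (β≤gt s c (near≢t (n≤1+n s)) c≢t))
    (recurse Y split₁ (s≤s γ≤1) Yc≡1+γ Y1+s≡1 (inner≡2′ (suc s) s ≤-refl (inj₁ (n≤1+n s)))
             (β≤gt (suc s) s (near≢t ≤-refl) (near≢t (n≤1+n s))))
    where
    X = decAt s (decAt c f)
    Y = decAt (suc s) (decAt s f)
    Xc≡γ : lookupD X c ≡ γ
    Xc≡γ = trans (at (decAt c f) c≢s) (trans (lookupD-decAt-same c f) (cong (_∸ 1) fc≡1+γ))
    X1+s≡2 : lookupD X (suc s) ≡ 2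
    X1+s≡2 = trans (at (decAt c f) (s≢1+s ∘ sym)) (trans (at f (c≢1+s ∘ sym)) f1+s≡2)
    Xs≡0 : lookupD X s ≡ 0
    Xs≡0 = trans (lookupD-decAt-same s (decAt c f)) (cong (_∸ 1) (trans (at f (c≢s ∘ sym)) fs≡1))
    Yc≡1+γ : lookupD Y c ≡ suc γ
    Yc≡1+γ = trans (at (decAt s f) c≢1+s) (trans (at f c≢s) fc≡1+γ)
    Y1+s≡1 : lookupD Y (suc s) ≡ 1
    Y1+s≡1 = trans (lookupD-decAt-same (suc s) (decAt s f)) (cong (_∸ 1) (trans (at f (s≢1+s ∘ sym)) f1+s≡2))
    Ys≡0 : lookupD Y s ≡ 0
    Ys≡0 = trans (at (decAt s f) s≢1+s) (trans (lookupD-decAt-same s f) (cong (_∸ 1) fs≡1))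
    -- Both terms of fanStart₁ survive; their residuals agree, so they combine into one multiple of k F.
    combine : FanResult m (suc s) t c k X 2 β → FanResult m (suc s) t c k Y 1 β → FanResult (suc m) s t c k f 1 β
    combine (F , r , eq) (F′ , r′ , eq′) = F , residual , coefficient
      where
      residual : Residual (FanZone c s t) t β f F
      residual = residual-decAt Zc ¬Zt (residual-decAt Zs ¬Zt (widen Xs≡0 r))
      residual′ : Residual (FanZone c s t) t β f F′
      residual′ = residual-decAt Zs ¬Zt (residual-decAt Z1+s ¬Zt (widen Ys≡0 r′))
      kF′≡kF : k F′ ≡ k F
      kF′≡kF = k-cong F′ F (residual-unique (fanZone? c s t) ¬Zt residual′ residual)
      coefficient : coeffMul (fanEdges c s (suc m)) k f ≡ transfer (suc m) 1 β *ℤ k F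
      coefficient = trans (fanEdges-reorder (suc m) s c k f) (trans (fanStart₁ c s R k f c≢s fs≡1 fc≡1+γ avoids (k-van s Zs))
        (trans (cong₂ _+ℤ_ eq (trans (choose-suc R k (decAt s f) (suc s) (trans (at f (s≢1+s ∘ sym)) f1+s≡2))
                                (trans eq′ (cong (transfer m 1 β *ℤ_) kF′≡kF))))
               (sym (ℤ.*-distribʳ-+ (k F) (transfer m 2 β) (transfer m 1 β)))))

fanBlock : ∀ m s t c k f {γ A β} → FanSplit γ A β → suc (s + m) ≡ t → t < c → γ ≤ suc (suc m) → lookupD f c ≡ γ →
  lookupD f s ≡ A → (∀ y → s < y → y < t → lookupD f y ≡ 2) → β ≤ lookupD f t → VanishesOn (FanZone c s t) k → Congruent k →
  FanResult m s t c k f A β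
fanBlock zero s t c k f split t≡ t<c γ≤2 fc≡γ fs≡A inner≡2 β≤ft k-van k-cong with trans (cong suc (sym (+-identityʳ s))) t≡
... | refl = FanBase.fanBase s c k f t<c k-van split γ≤2 fc≡γ fs≡A β≤ft k-cong
fanBlock (suc m) s t c k f {β = β} split t≡ t<c _ fc≡γ fs≡A inner≡2 β≤ft k-van k-cong = dispatch split fc≡γ fs≡A
  where
  t≡′ : suc (suc s + m) ≡ t
  t≡′ = trans (cong suc (sym (+-suc s m))) t≡
  1+s<t : suc s < t
  1+s<t = subst (suc s <_) t≡ (s≤s (subst (suc s ≤_) (sym (+-suc s m)) (s≤s (m≤m+n s m))))
  k-van′ : VanishesOn (FanZone c (suc s) t) k
  k-van′ y (inj₁ y≡c)           = k-van y (inj₁ y≡c)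
  k-van′ y (inj₂ (1+s≤y , y<t)) = k-van y (inj₂ (<⇒≤ 1+s≤y , y<t))
  open FanStep m s t c k f β 1+s<t t<c inner≡2 β≤ft k-van k-cong
    (λ g split′ γ≤2 gc≡ g1+s≡ inner′ β≤gt′ →
      fanBlock m (suc s) t c k g split′ t≡′ t<c (≤-trans γ≤2 (s≤s (s≤s z≤n))) gc≡ g1+s≡ inner′ β≤gt′ k-van′ k-cong)
  dispatch : ∀ {γ A} → FanSplit γ A β → lookupD f c ≡ γ → lookupD f s ≡ A → FanResult (suc m) s t c k f A β
  dispatch split300 fc≡ fs≡ = step₀ fc≡ ≤-refl split210 fs≡
  dispatch split201 fc≡ fs≡ = step₀ fc≡ (s≤s z≤n) split111 fs≡
  dispatch split210 fc≡ fs≡ = step₁ fc≡ ≤-refl split120 split210 fs≡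
  dispatch split111 fc≡ fs≡ = step₁ fc≡ z≤n split021 split111 fs≡
  dispatch split120 fc≡ fs≡ = step₂ fc≡ (s≤s z≤n) split120 fs≡
  dispatch split021 fc≡ fs≡ = step₂ fc≡ z≤n split021 fs≡

isEven : ℕ → Bool
isEven zero          = true
isEven (suc zero)    = false
isEven (suc (suc n)) = isEven n

isEven-suc : ∀ n → isEven (suc n) ≡ not (isEven n)
isEven-suc zero          = refl
isEven-suc (suc zero)    = refl
isEven-suc (suc (suc n)) = isEven-suc n

-- A fan block with m + 2 spokes belongs to a wheel with m + 3 rim vertices.
record OddWheelTable (T : ℕ → ℕ → ℤ) : Set where
  field
    t01 : T 0 1 ≡ -1ℤ
    t10 : T 1 0 ≡ 1ℤ
    t11 : T 1 1 ≡ 0ℤ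
    t20 : T 2 0 ≡ -1ℤ
    t21 : T 2 1 ≡ 1ℤ

record EvenWheelTable (T : ℕ → ℕ → ℤ) : Set where
  field
    t00 : T 0 0 ≡ -1ℤ
    t10 : T 1 0 ≡ 0ℤ
    t11 : T 1 1 ≡ 1ℤ
    t20 : T 2 0 ≡ 1ℤ
    t21 : T 2 1 ≡ -1ℤ

odd⇒even-table : ∀ m → OddWheelTable (transfer m) → EvenWheelTable (transfer (suc m))
odd⇒even-table m o = record
  { t00 = cong -_ t10 ; t10 = cong₂ _+ℤ_ t20 t10 ; t11 = cong₂ _+ℤ_ t21 t11 ; t20 = cong -_ t20 ; t21 = cong -_ t21 }
  where open OddWheelTable o

even⇒odd-table : ∀ m → EvenWheelTable (transfer m) → OddWheelTable (transfer (suc m))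
even⇒odd-table m e = record
  { t01 = cong -_ t11 ; t10 = cong₂ _+ℤ_ t20 t10 ; t11 = cong₂ _+ℤ_ t21 t11 ; t20 = cong -_ t20 ; t21 = cong -_ t21 }
  where open EvenWheelTable e

transfer-table : ∀ m → (isEven m ≡ true → OddWheelTable (transfer m)) × (isEven m ≡ false → EvenWheelTable (transfer m))
transfer-table zero          = (λ _ → record { t01 = refl ; t10 = refl ; t11 = refl ; t20 = refl ; t21 = refl }) , (λ ())
transfer-table (suc zero)    = (λ ()) , (λ _ → odd⇒even-table zero (proj₁ (transfer-table zero) refl))
transfer-table (suc (suc m)) = (even⇒odd-table (suc m) ∘ odd⇒even-table m ∘ proj₁ (transfer-table m)) ,
                               (odd⇒even-table (suc m) ∘ even⇒odd-table m ∘ proj₂ (transfer-table m))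

-- The exponent pattern along the chain of blocks

<ᵇ-true : ∀ {m n} → m < n → (m <ᵇ n) ≡ true
<ᵇ-true m<n = Equivalence.to T-≡ (<⇒<ᵇ m<n)

<ᵇ-false : ∀ {m n} → n ≤ m → (m <ᵇ n) ≡ false
<ᵇ-false {m} {n} n≤m with m <ᵇ n in m<ᵇn
... | false = refl
... | true  = ⊥-elim (<⇒≱ (<ᵇ⇒< m n (Equivalence.from T-≡ m<ᵇn)) n≤m)

inside : ℕ → ℕ → ℕ → ℕ → ℕ
inside s t v y = if (s <ᵇ y) ∧ (y <ᵇ t) then v else 0

inside-in : ∀ {s t v y} → s < y → y < t → inside s t v y ≡ v
inside-in s<y y<t rewrite <ᵇ-true s<y | <ᵇ-true y<t = refl

inside-below : ∀ {s t v y} → y ≤ s → inside s t v y ≡ 0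
inside-below y≤s rewrite <ᵇ-false y≤s = refl

inside-above : ∀ {s t v y} → t ≤ y → inside s t v y ≡ 0
inside-above {s} {y = y} t≤y with s <ᵇ y
... | false = refl
... | true rewrite <ᵇ-false t≤y = refl

inside-shift : ∀ {s t v y} → suc s < y → inside (suc s) t v y ≡ inside s t v y
inside-shift 1+s<y rewrite <ᵇ-true 1+s<y | <ᵇ-true (<⇒≤ 1+s<y) = refl

outside-inside : ∀ {s n y} v → OutsideRim s n y → inside s (s + n) v y ≡ 0
outside-inside {s} {n} v (inj₁ y<s)   = inside-below {t = s + n} (<⇒≤ y<s)
outside-inside         v (inj₂ end<y) = inside-above (<⇒≤ end<y)

outside-inside′ : ∀ {s n y} v → OutsideRim s n y → inside s (suc (s + n)) v y ≡ 0
outside-inside′ {s} {n} v (inj₁ y<s)   = inside-below {t = suc (s + n)} (<⇒≤ y<s)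
outside-inside′         v (inj₂ end<y) = inside-above end<y

rimLength : Comp → ℕ
rimLength x = size x ∸ 2

totalRim : List Comp → ℕ
totalRim cs = sum (map (λ c → size c ∸ 2) cs)

totalRim-∷ : ∀ s x cs → s + totalRim (x ∷ cs) ≡ (s + rimLength x) + totalRim cs
totalRim-∷ s x cs = sym (+-assoc s (rimLength x) (totalRim cs))

tail-fits : ∀ s x cs {c} → s + totalRim (x ∷ cs) < c → (s + rimLength x) + totalRim cs < c
tail-fits s x cs {c} = subst (_< c) (totalRim-∷ s x cs)

block-fits : ∀ s x cs {c} → s + totalRim (x ∷ cs) < c → s + rimLength x < c
block-fits s x cs end<c = ≤-<-trans (m≤m+n _ (totalRim cs)) (tail-fits s x cs end<c)

isEvenWheel : Comp → Bool
isEvenWheel (comp ordinary k) = isEven k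
isEvenWheel (comp broken _)   = false

-- The exponents A at the first rim vertex, β taken at the last one, and γ at the centre of a block, given
-- whether an even wheel came earlier: each block hands its spare unit on to the next shared rim vertex until
-- an even wheel, whose centre absorbs it; afterwards every block keeps it at its own start. So v₂ and v_k get 0.
startExp : Bool → Comp → ℕ
startExp seen x = if isEvenWheel x then 0 else (if seen then 1 else 0)

endExp : Bool → Comp → ℕ
endExp seen x = if isEvenWheel x then 0 else (if seen then 0 else 1)

centreExp : Comp → ℕ
centreExp x = if isEvenWheel x then 3 else 2

seenAfter : Bool → Comp → Bool
seenAfter seen x = seen ∨ isEvenWheel x

blockExp : Bool → ℕ → ℕ → Comp → ℕ → ℕ
blockExp seen s c x@(comp ordinary k) y =
  [ c ↦ centreExp x ] y + ([ s ↦ startExp seen x ] y + ([ s + (k ∸ 2) ↦ endExp seen x ] y + inside s (s + (k ∸ 2)) 2 y))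
blockExp seen s c x@(comp broken k) y =
  [ s ↦ startExp seen x ] y + ([ s + (k ∸ 2) ↦ endExp seen x ] y + inside s (s + (k ∸ 2)) 1 y)

blockDegV₁ : Bool → ℕ → ℕ → Comp → ℕ → ℕ
blockDegV₁ first s c (comp ordinary k) y = (if first then [ s ↦ 1 ] y else 0) + ([ s + (k ∸ 2) ↦ 1 ] y + [ c ↦ 1 ] y)
blockDegV₁ first s c (comp broken k)   y = (if first then [ s ↦ 1 ] y else 0) + inside s (suc (s + (k ∸ 2))) 1 y

sumBlocks : (Bool → Comp → Bool) → (Bool → ℕ → ℕ → Comp → ℕ → ℕ) → Bool → ℕ → ℕ → List Comp → ℕ → ℕ
sumBlocks next B σ s c []       y = 0
sumBlocks next B σ s c (x ∷ cs) y = B σ s c x y + sumBlocks next B (next σ x) (s + rimLength x) (nextCentre x c) cs y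

chainExp : Bool → ℕ → ℕ → List Comp → ℕ → ℕ
chainExp = sumBlocks seenAfter blockExp

chainDegV₁ : Bool → ℕ → ℕ → List Comp → ℕ → ℕ
chainDegV₁ = sumBlocks (λ _ _ → false) blockDegV₁

OutsideCentres : ℕ → ℕ → ℕ → Set
OutsideCentres c n y = y < c ⊎ c + n ≤ y

nextCentre-≤ : ∀ x c → c ≤ nextCentre x c
nextCentre-≤ (comp ordinary _) c = n≤1+n c
nextCentre-≤ (comp broken _)   c = ≤-refl

nextCentre-+ : ∀ x c cs → nextCentre x c + countOrd cs ≡ c + countOrd (x ∷ cs)
nextCentre-+ (comp ordinary _) c cs = sym (+-suc c (countOrd cs))
nextCentre-+ (comp broken _)   c cs = refl

outsideRim-head : ∀ {s y} x cs → OutsideRim s (totalRim (x ∷ cs)) y → OutsideRim s (rimLength x) y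
outsideRim-head x cs (inj₁ y<s) = inj₁ y<s
outsideRim-head {s} {y} x cs (inj₂ end<y) =
  inj₂ (≤-<-trans (m≤m+n (s + rimLength x) (totalRim cs)) (subst (_< y) (totalRim-∷ s x cs) end<y))

outsideRim-tail : ∀ {s y} x cs → OutsideRim s (totalRim (x ∷ cs)) y → OutsideRim (s + rimLength x) (totalRim cs) y
outsideRim-tail {s} x cs (inj₁ y<s)   = inj₁ (<-≤-trans y<s (m≤m+n s (rimLength x)))
outsideRim-tail {s} {y} x cs (inj₂ end<y) = inj₂ (subst (_< y) (totalRim-∷ s x cs) end<y)

outsideCentres-head : ∀ {c y} x cs → OutsideCentres c (countOrd (x ∷ cs)) y → y < c ⊎ nextCentre x c ≤ y
outsideCentres-head x cs (inj₁ y<c) = inj₁ y<c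
outsideCentres-head {c} x cs (inj₂ end≤y) = inj₂ (≤-trans (subst (nextCentre x c ≤_) (nextCentre-+ x c cs) (m≤m+n _ _)) end≤y)

outsideCentres-tail : ∀ {c y} x cs → OutsideCentres c (countOrd (x ∷ cs)) y → OutsideCentres (nextCentre x c) (countOrd cs) y
outsideCentres-tail {c} x cs (inj₁ y<c)   = inj₁ (<-≤-trans y<c (nextCentre-≤ x c))
outsideCentres-tail {c} {y} x cs (inj₂ end≤y) = inj₂ (subst (_≤ y) (sym (nextCentre-+ x c cs)) end≤y)

BlockSupported : (Bool → ℕ → ℕ → Comp → ℕ → ℕ) → Set
BlockSupported B = ∀ σ s c x y → OutsideRim s (rimLength x) y → (y < c ⊎ nextCentre x c ≤ y) → B σ s c x y ≡ 0

sumBlocks-supported : ∀ next B → BlockSupported B → ∀ σ s c cs y →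
  OutsideRim s (totalRim cs) y → OutsideCentres c (countOrd cs) y → sumBlocks next B σ s c cs y ≡ 0
sumBlocks-supported next B B-supp σ s c []       y out-rim out-c = refl
sumBlocks-supported next B B-supp σ s c (x ∷ cs) y out-rim out-c =
  cong₂ _+_ (B-supp σ s c x y (outsideRim-head x cs out-rim) (outsideCentres-head x cs out-c))
            (sumBlocks-supported next B B-supp (next σ x) (s + rimLength x) (nextCentre x c) cs y
              (outsideRim-tail x cs out-rim) (outsideCentres-tail x cs out-c))

outside-first : ∀ {s n y} (first : Bool) → OutsideRim s n y → (if first then [ s ↦ 1 ] y else 0) ≡ 0
outside-first true  out = ↦-elsewhere (outside-≢start out)
outside-first false out = refl

≢centre : ∀ {c y} → y < c ⊎ suc c ≤ y → c ≢ y
≢centre (inj₁ y<c)   = <⇒≢ y<c ∘ sym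
≢centre (inj₂ c<y)   = <⇒≢ c<y

blockExp-supported : BlockSupported blockExp
blockExp-supported seen s c (comp ordinary k) y out-rim out-c =
  cong₂ _+_ (↦-elsewhere (≢centre out-c)) (cong₂ _+_ (↦-elsewhere (outside-≢start out-rim))
    (cong₂ _+_ (↦-elsewhere (outside-≢end out-rim)) (outside-inside 2 out-rim)))
blockExp-supported seen s c (comp broken k) y out-rim out-c =
  cong₂ _+_ (↦-elsewhere (outside-≢start out-rim)) (cong₂ _+_ (↦-elsewhere (outside-≢end out-rim)) (outside-inside 1 out-rim))

blockDegV₁-supported : BlockSupported blockDegV₁
blockDegV₁-supported first s c (comp ordinary k) y out-rim out-c =
  cong₂ _+_ (outside-first first out-rim) (cong₂ _+_ (↦-elsewhere (outside-≢end out-rim)) (↦-elsewhere (≢centre out-c)))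
blockDegV₁-supported first s c (comp broken k) y out-rim out-c =
  cong₂ _+_ (outside-first first out-rim) (outside-inside′ 1 out-rim)

chainExp-supported : ∀ seen s c cs y → OutsideRim s (totalRim cs) y → OutsideCentres c (countOrd cs) y → chainExp seen s c cs y ≡ 0
chainExp-supported = sumBlocks-supported seenAfter blockExp blockExp-supported

chainDegV₁-supported : ∀ first s c cs y → OutsideRim s (totalRim cs) y → OutsideCentres c (countOrd cs) y →
  chainDegV₁ first s c cs y ≡ 0
chainDegV₁-supported = sumBlocks-supported (λ _ _ → false) blockDegV₁ blockDegV₁-supported

ordWheel : ℕ → Comp
ordWheel m = comp ordinary (suc (suc (suc m)))

brkWheel : ℕ → Comp
brkWheel m = comp broken (suc (suc (suc m)))

module BlockValues (seen first : Bool) (s c m : ℕ) (t<c : s + suc m < c) where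

  t : ℕ
  t = s + suc m

  s<t : s < t
  s<t = m<m+n s (s≤s z≤n)

  s≢c : s ≢ c
  s≢c = <⇒≢ (<-trans s<t t<c)

  t≢c : t ≢ c
  t≢c = <⇒≢ t<c

  s≢t : s ≢ t
  s≢t = <⇒≢ s<t

  first-inner : ∀ {y} → s < y → (if first then [ s ↦ 1 ] y else 0) ≡ 0
  first-inner {y} s<y = outside-first {n = 0} first (inj₂ (subst (_< y) (sym (+-identityʳ s)) s<y))

  ordExp-inner : ∀ y → s < y → y < t → blockExp seen s c (ordWheel m) y ≡ 2
  ordExp-inner y s<y y<t = cong₂ _+_ (↦-elsewhere (<⇒≢ (<-trans y<t t<c) ∘ sym))
    (cong₂ _+_ (↦-elsewhere (<⇒≢ s<y)) (cong₂ _+_ (↦-elsewhere (<⇒≢ y<t ∘ sym)) (inside-in s<y y<t)))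

  ordDeg-inner : ∀ y → s < y → y < t → blockDegV₁ first s c (ordWheel m) y ≡ 0
  ordDeg-inner y s<y y<t = cong₂ _+_ (first-inner s<y)
    (cong₂ _+_ (↦-elsewhere (<⇒≢ y<t ∘ sym)) (↦-elsewhere (<⇒≢ (<-trans y<t t<c) ∘ sym)))

  brkExp-inner : ∀ y → s < y → y < t → blockExp seen s c (brkWheel m) y ≡ 1
  brkExp-inner y s<y y<t = cong₂ _+_ (↦-elsewhere (<⇒≢ s<y)) (cong₂ _+_ (↦-elsewhere (<⇒≢ y<t ∘ sym)) (inside-in s<y y<t))

  brkDeg-inner : ∀ y → s < y → y < t → blockDegV₁ first s c (brkWheel m) y ≡ 1
  brkDeg-inner y s<y y<t = cong₂ _+_ (first-inner s<y) (inside-in s<y (m<n⇒m<1+n y<t))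

  ordExp-end : blockExp seen s c (ordWheel m) t ≡ endExp seen (ordWheel m)
  ordExp-end = trans (cong₂ _+_ (↦-elsewhere (t≢c ∘ sym)) (cong₂ _+_ (↦-elsewhere s≢t)
    (cong₂ _+_ (↦-here t _) (inside-above {s} {t} ≤-refl)))) (+-identityʳ _)

  ordDeg-end : blockDegV₁ first s c (ordWheel m) t ≡ 1
  ordDeg-end = cong₂ _+_ (first-inner s<t) (cong₂ _+_ (↦-here t 1) (↦-elsewhere (t≢c ∘ sym)))

  brkExp-end : blockExp seen s c (brkWheel m) t ≡ endExp seen (brkWheel m)
  brkExp-end = trans (cong₂ _+_ (↦-elsewhere s≢t) (cong₂ _+_ (↦-here t _) (inside-above {s} {t} ≤-refl))) (+-identityʳ _)

  brkDeg-end : blockDegV₁ first s c (brkWheel m) t ≡ 1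
  brkDeg-end = cong₂ _+_ (first-inner s<t) (inside-in s<t ≤-refl)

  ordExp-start : blockExp seen s c (ordWheel m) s ≡ startExp seen (ordWheel m)
  ordExp-start = trans (cong₂ _+_ (↦-elsewhere (s≢c ∘ sym)) (cong₂ _+_ (↦-here s _)
    (cong₂ _+_ (↦-elsewhere (s≢t ∘ sym)) (inside-below {s} {t} ≤-refl)))) (+-identityʳ _)

  brkExp-start : blockExp seen s c (brkWheel m) s ≡ startExp seen (brkWheel m)
  brkExp-start = trans (cong₂ _+_ (↦-here s _) (cong₂ _+_ (↦-elsewhere (s≢t ∘ sym)) (inside-below {s} {t} ≤-refl))) (+-identityʳ _)

  ordDeg-start : blockDegV₁ false s c (ordWheel m) s ≡ 0
  ordDeg-start = cong₂ _+_ refl (cong₂ _+_ (↦-elsewhere (s≢t ∘ sym)) (↦-elsewhere (s≢c ∘ sym)))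

  brkDeg-start : blockDegV₁ false s c (brkWheel m) s ≡ 0
  brkDeg-start = inside-below {s} {suc t} ≤-refl

  ordExp-centre : blockExp seen s c (ordWheel m) c ≡ centreExp (ordWheel m)
  ordExp-centre = trans (cong₂ _+_ (↦-here c _) (cong₂ _+_ (↦-elsewhere s≢c)
    (cong₂ _+_ (↦-elsewhere t≢c) (inside-above {s} {t} (<⇒≤ t<c))))) (+-identityʳ _)

  ordDeg-centre : blockDegV₁ first s c (ordWheel m) c ≡ 1
  ordDeg-centre = cong₂ _+_ (first-inner (<-trans s<t t<c)) (cong₂ _+_ (↦-elsewhere t≢c) (↦-here c 1))

  blockTotal-inner : ∀ kind y → s < y → y < t →
    blockExp seen s c (comp kind (3 + m)) y + blockDegV₁ first s c (comp kind (3 + m)) y ≡ 2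
  blockTotal-inner ordinary y s<y y<t = cong₂ _+_ (ordExp-inner y s<y y<t) (ordDeg-inner y s<y y<t)
  blockTotal-inner broken   y s<y y<t = cong₂ _+_ (brkExp-inner y s<y y<t) (brkDeg-inner y s<y y<t)

  blockExp-end : ∀ kind → blockExp seen s c (comp kind (3 + m)) t ≡ endExp seen (comp kind (3 + m))
  blockExp-end ordinary = ordExp-end
  blockExp-end broken   = brkExp-end

  blockDeg-end : ∀ kind → blockDegV₁ first s c (comp kind (3 + m)) t ≡ 1
  blockDeg-end ordinary = ordDeg-end
  blockDeg-end broken   = brkDeg-end

  blockExp-start : ∀ kind → blockExp seen s c (comp kind (3 + m)) s ≡ startExp seen (comp kind (3 + m))
  blockExp-start ordinary = ordExp-start
  blockExp-start broken   = brkExp-start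

  blockDeg-start : ∀ kind → blockDegV₁ false s c (comp kind (3 + m)) s ≡ 0
  blockDeg-start ordinary = ordDeg-start
  blockDeg-start broken   = brkDeg-start

-- The coefficient of the chain

rimChain : ℕ → ℕ → List Comp → List Edge
rimChain s c []                     = []
rimChain s c (comp ordinary k ∷ cs) = (fan c s (k ∸ 1) ++ pathEdges s (k ∸ 2)) ++ rimChain (s + (k ∸ 2)) (suc c) cs
rimChain s c (comp broken k ∷ cs)   = pathEdges s (k ∸ 2) ++ rimChain (s + (k ∸ 2)) c cs

WellSized : List Comp → Set
WellSized = All (λ x → 3 ≤ size x)

avoids-rimChain : ∀ cs s c y → WellSized cs → OutsideRim s (totalRim cs) y → OutsideCentres c (countOrd cs) y →
  Avoids y (rimChain s c cs)
avoids-rimChain [] s c y _ out-rim out-c = []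
avoids-rimChain (x@(comp ordinary (suc (suc (suc m)))) ∷ cs) s c y (s≤s (s≤s (s≤s _)) ∷ sized) out-rim out-c =
  ++⁺ (++⁺ (avoids-fan (≢centre (outsideCentres-head x cs out-c)) (outsideRim-head x cs out-rim))
           (avoids-pathEdges (outsideRim-head x cs out-rim)))
      (avoids-rimChain cs (s + suc m) (suc c) y sized (outsideRim-tail x cs out-rim) (outsideCentres-tail x cs out-c))
avoids-rimChain (x@(comp broken (suc (suc (suc m)))) ∷ cs) s c y (s≤s (s≤s (s≤s _)) ∷ sized) out-rim out-c =
  ++⁺ (avoids-pathEdges (outsideRim-head x cs out-rim))
      (avoids-rimChain cs (s + suc m) c y sized (outsideRim-tail x cs out-rim) (outsideCentres-tail x cs out-c))

ordWheel-split : ∀ seen m → FanSplit (centreExp (ordWheel m)) (startExp seen (ordWheel m)) (endExp seen (ordWheel m))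
ordWheel-split seen m with isEven (suc m)
... | true = split300
ordWheel-split true  m | false = split210
ordWheel-split false m | false = split201

ordWheel-centreExp≤ : ∀ m → centreExp (ordWheel m) ≤ suc (suc m)
ordWheel-centreExp≤ zero    = ≤-refl
ordWheel-centreExp≤ (suc m) with isEven m
... | true  = s≤s (s≤s (s≤s z≤n))
... | false = s≤s (s≤s z≤n)

∣transfer∣≡1 : ∀ seen m → ∣ transfer m (startExp seen (ordWheel m)) (endExp seen (ordWheel m)) ∣ ≡ 1
∣transfer∣≡1 seen m rewrite isEven-suc m with isEven m in m-even
... | false = cong ∣_∣ (EvenWheelTable.t00 (proj₂ (transfer-table m) m-even))
∣transfer∣≡1 true  m | true = cong ∣_∣ (OddWheelTable.t10 (proj₁ (transfer-table m) m-even))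
∣transfer∣≡1 false m | true = cong ∣_∣ (OddWheelTable.t01 (proj₁ (transfer-table m) m-even))

brkWheel-split : ∀ seen m → PathSplit (startExp seen (brkWheel m)) (endExp seen (brkWheel m))
brkWheel-split true  m = takeStart
brkWheel-split false m = takeEnd

chain-peel : ∀ {Z : ℕ → Set} {t β} σ B R f F (block rest : ℕ → ℕ) → (∀ y → Dec (Z y)) → Residual Z t β f F →
  coeffMul B (coeff R) f ≡ σ *ℤ coeff R F → ∣ σ ∣ ≡ 1 →
  (∀ y → lookupD f y ≡ block y + rest y) → (∀ y → Z y → rest y ≡ 0) → block t ≡ β →
  (∀ y → ¬ Z y → y ≢ t → block y ≡ 0) →
  ((∀ y → lookupD F y ≡ rest y) → ∣ coeff R F ∣ ≡ 1) → ∣ coeff (B ++ R) f ∣ ≡ 1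
chain-peel σ B R f F block rest Z? r eq ∣σ∣≡1 f≡ rest≡0 block-t block≡0 rest-unit =
  begin
    ∣ coeff (B ++ R) f ∣   ≡⟨ cong ∣_∣ (trans (coeff-++ B R f) eq) ⟩
    ∣ σ *ℤ coeff R F ∣     ≡⟨ ℤ.abs-* σ (coeff R F) ⟩
    ∣ σ ∣ * ∣ coeff R F ∣  ≡⟨ cong₂ _*_ ∣σ∣≡1 (rest-unit (residual-of-sum block rest Z? r f≡ rest≡0 block-t block≡0)) ⟩
    1                      ∎
  where open ≡-Reasoning

chain : ∀ cs seen s c f → WellSized cs → s + totalRim cs < c →
  (∀ y → lookupD f y ≡ chainExp seen s c cs y) → ∣ coeff (rimChain s c cs) f ∣ ≡ 1
chain [] seen s c f _ _ f≡ = cong ∣_∣ (coeff-[] f f≡)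
chain (x@(comp ordinary (suc (suc (suc m)))) ∷ cs) seen s c f (s≤s (s≤s (s≤s _)) ∷ sized) end<c f≡ =
  finish (fanBlock m s t c (coeff R) f (ordWheel-split seen m) (sym (+-suc s m)) t<c (ordWheel-centreExp≤ m)
           (at-zone c (inj₁ refl) ordExp-centre) (at-zone s Zs ordExp-start)
           (λ y s<y y<t → at-zone y (inj₂ (<⇒≤ s<y , y<t)) (ordExp-inner y s<y y<t))
           (subst (endExp seen x ≤_) (sym (trans (f≡ t) (cong (_+ rest t) ordExp-end))) (m≤m+n _ (rest t)))
           rest-avoids (coeff-congruent R))
  where
  R = rimChain (s + suc m) (suc c) cs
  rest = chainExp (seenAfter seen x) (s + suc m) (suc c) cs
  t+rim<c : s + suc m + totalRim cs < c
  t+rim<c = tail-fits s x cs end<c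
  t<c : s + suc m < c
  t<c = block-fits s x cs end<c
  open BlockValues seen false s c m t<c
  Zs : FanZone c s t s
  Zs = inj₂ (≤-refl , s<t)
  rest≡0 : ∀ y → FanZone c s t y → rest y ≡ 0
  rest≡0 y (inj₁ refl)        = chainExp-supported _ t (suc c) cs y (inj₂ t+rim<c) (inj₁ ≤-refl)
  rest≡0 y (inj₂ (_ , y<t)) = chainExp-supported _ t (suc c) cs y (inj₁ y<t) (inj₁ (<-trans y<t (<-trans t<c ≤-refl)))
  at-zone : ∀ y {v} → FanZone c s t y → blockExp seen s c x y ≡ v → lookupD f y ≡ v
  at-zone y {v} Zy block≡v = trans (f≡ y) (trans (cong₂ _+_ block≡v (rest≡0 y Zy)) (+-identityʳ v))
  rest-avoids : VanishesOn (FanZone c s t) (coeff R)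
  rest-avoids y (inj₁ refl) = coeff-vanish R (avoids-rimChain cs t (suc c) y sized (inj₂ t+rim<c) (inj₁ ≤-refl))
  rest-avoids y (inj₂ (_ , y<t)) =
    coeff-vanish R (avoids-rimChain cs t (suc c) y sized (inj₁ y<t) (inj₁ (<-trans y<t (<-trans t<c ≤-refl))))
  block≡0 : ∀ y → ¬ FanZone c s t y → y ≢ t → blockExp seen s c x y ≡ 0
  block≡0 y y∉ y≢t = blockExp-supported seen s c x y (outside-Between (y∉ ∘ inj₂) y≢t) (≢-split (y∉ ∘ inj₁))
  finish : FanResult m s t c (coeff R) f (startExp seen x) (endExp seen x) → ∣ coeff (rimChain s c (x ∷ cs)) f ∣ ≡ 1
  finish (F , r , eq) = chain-peel (transfer m (startExp seen x) (endExp seen x)) (fanEdges c s m) R f F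
    (blockExp seen s c x) rest (fanZone? c s t) r eq (∣transfer∣≡1 seen m)
    f≡ rest≡0 ordExp-end block≡0 (chain cs (seenAfter seen x) t (suc c) F sized (m<n⇒m<1+n t+rim<c))
chain (x@(comp broken (suc (suc (suc m)))) ∷ cs) seen s c f (s≤s (s≤s (s≤s _)) ∷ sized) end<c f≡ =
  finish (pathBlock m s t (coeff R) f (brkWheel-split seen m) (sym (+-suc s m))
           (at-zone s (≤-refl , s<t) brkExp-start) (λ y s<y y<t → at-zone y (<⇒≤ s<y , y<t) (brkExp-inner y s<y y<t))
           (subst (endExp seen x ≤_) (sym (trans (f≡ t) (cong (_+ rest t) brkExp-end))) (m≤m+n _ (rest t)))
           rest-avoids)
  where
  R = rimChain (s + suc m) c cs
  rest = chainExp (seenAfter seen x) (s + suc m) c cs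
  t+rim<c : s + suc m + totalRim cs < c
  t+rim<c = tail-fits s x cs end<c
  t<c : s + suc m < c
  t<c = block-fits s x cs end<c
  open BlockValues seen false s c m t<c
  rest≡0 : ∀ y → Between s t y → rest y ≡ 0
  rest≡0 y (_ , y<t) = chainExp-supported _ t c cs y (inj₁ y<t) (inj₁ (<-trans y<t t<c))
  at-zone : ∀ y {v} → Between s t y → blockExp seen s c x y ≡ v → lookupD f y ≡ v
  at-zone y {v} y∈ block≡v = trans (f≡ y) (trans (cong₂ _+_ block≡v (rest≡0 y y∈)) (+-identityʳ v))
  rest-avoids : VanishesOn (Between s t) (coeff R)
  rest-avoids y (_ , y<t) = coeff-vanish R (avoids-rimChain cs t c y sized (inj₁ y<t) (inj₁ (<-trans y<t t<c)))
  block≡0 : ∀ y → ¬ Between s t y → y ≢ t → blockExp seen s c x y ≡ 0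
  block≡0 y y∉ y≢t = blockExp-supported seen s c x y (outside-Between y∉ y≢t) (<⊎≥ y c)
  finish : PathResult m s t (coeff R) f (endExp seen x) → ∣ coeff (rimChain s c (x ∷ cs)) f ∣ ≡ 1
  finish (F , r , σ , ∣σ∣≡1 , eq) = chain-peel σ (pathEdges s (suc m)) R f F (blockExp seen s c x) rest (between? s t) r eq ∣σ∣≡1
    f≡ rest≡0 brkExp-end block≡0 (chain cs (seenAfter seen x) t c F sized t+rim<c)

withoutV₁-deleteEdge : ∀ a E → withoutV₁ (deleteEdge 0 a E) ≡ withoutV₁ E
withoutV₁-deleteEdge a [] = refl
withoutV₁-deleteEdge a ((u , v) ∷ E) with sameEdge 0 a (u , v) in same
... | true  = trans (withoutV₁-deleteEdge a E) (sym (dropped (at-v₁ (u ≡ᵇ 0) (v ≡ᵇ a) (v ≡ᵇ 0) (u ≡ᵇ a) same)))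
  where
  at-v₁ : ∀ p q r s → ((p ∧ q) ∨ (s ∧ r)) ≡ true → (p ∨ r) ≡ true
  at-v₁ true  q r     s _  = refl
  at-v₁ false q true  s _  = refl
  at-v₁ false q false true  ()
  at-v₁ false q false false ()
  dropped : ((u ≡ᵇ 0) ∨ (v ≡ᵇ 0)) ≡ true → withoutV₁ ((u , v) ∷ E) ≡ withoutV₁ E
  dropped at-0 rewrite at-0 = refl
... | false with (u ≡ᵇ 0) ∨ (v ≡ᵇ 0)
...   | true  = withoutV₁-deleteEdge a E
...   | false = cong ((u , v) ∷_) (withoutV₁-deleteEdge a E)

degV₁-deleteEdge-≤ : ∀ a E y → degV₁ (deleteEdge 0 a E) y ≤ degV₁ E y
degV₁-deleteEdge-≤ a []            y = ≤-refl
degV₁-deleteEdge-≤ a ((u , v) ∷ E) y with sameEdge 0 a (u , v)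
... | true  = ≤-trans (degV₁-deleteEdge-≤ a E y) (m≤n+m _ _)
... | false = +-monoʳ-≤ (degV₁-edge u v y) (degV₁-deleteEdge-≤ a E y)

degV₁-deleteEdge-self : ∀ a E → degV₁ (deleteEdge 0 a E) a ≡ 0
degV₁-deleteEdge-self a []            = refl
degV₁-deleteEdge-self a ((u , v) ∷ E) with sameEdge 0 a (u , v) in same
... | true  = degV₁-deleteEdge-self a E
... | false = cong₂ _+_ (other-edge (u ≡ᵇ 0) (v ≡ᵇ a) (v ≡ᵇ 0) (u ≡ᵇ a) same) (degV₁-deleteEdge-self a E)
  where
  other-edge : ∀ p q r s → ((p ∧ q) ∨ (s ∧ r)) ≡ false →
    (if p then (if q then 1 else 0) else (if r then (if s then 1 else 0) else 0)) ≡ 0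
  other-edge true  true  r s     ()
  other-edge true  false r s     _ = refl
  other-edge false q     true true  ()
  other-edge false q     true false _ = refl
  other-edge false q     false s    _ = refl

withoutV₁-++ : ∀ A B → withoutV₁ (A ++ B) ≡ withoutV₁ A ++ withoutV₁ B
withoutV₁-++ []            B = refl
withoutV₁-++ ((u , v) ∷ A) B with (u ≡ᵇ 0) ∨ (v ≡ᵇ 0)
... | true  = withoutV₁-++ A B
... | false = cong ((u , v) ∷_) (withoutV₁-++ A B)

withoutV₁-fan : ∀ c s n → withoutV₁ (fan (suc c) (suc s) n) ≡ fan (suc c) (suc s) n
withoutV₁-fan c s zero    = refl
withoutV₁-fan c s (suc n) = cong ((suc c , suc s) ∷_) (withoutV₁-fan c (suc s) n)

withoutV₁-fanV₁ : ∀ s n → withoutV₁ (fan 0 s n) ≡ []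
withoutV₁-fanV₁ s zero    = refl
withoutV₁-fanV₁ s (suc n) = withoutV₁-fanV₁ (suc s) n

withoutV₁-pathEdges : ∀ s n → withoutV₁ (pathEdges (suc s) n) ≡ pathEdges (suc s) n
withoutV₁-pathEdges s zero    = refl
withoutV₁-pathEdges s (suc n) = cong ((suc s , suc (suc s)) ∷_) (withoutV₁-pathEdges (suc s) n)

withoutV₁-first : ∀ first s X → withoutV₁ ((if first then (0 , s) ∷ [] else []) ++ X) ≡ withoutV₁ X
withoutV₁-first true  s X = refl
withoutV₁-first false s X = refl

withoutV₁-buildEdges : ∀ first s c cs → withoutV₁ (buildEdges first (suc s) (suc c) cs) ≡ rimChain (suc s) (suc c) cs
withoutV₁-buildEdges first s c [] = refl
withoutV₁-buildEdges first s c (comp ordinary k ∷ cs) =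
  trans (withoutV₁-++ (compEdges first (suc s) (suc c) (comp ordinary k)) _)
    (cong₂ _++_ (trans (withoutV₁-first first (suc s) _)
                  (trans (withoutV₁-++ (fan (suc c) (suc s) (k ∸ 1)) (pathEdges (suc s) (k ∸ 2)))
                    (cong₂ _++_ (withoutV₁-fan c s (k ∸ 1)) (withoutV₁-pathEdges s (k ∸ 2)))))
                (withoutV₁-buildEdges false (s + (k ∸ 2)) (suc c) cs))
withoutV₁-buildEdges first s c (comp broken k ∷ cs) =
  trans (withoutV₁-++ (compEdges first (suc s) (suc c) (comp broken k)) _)
    (cong₂ _++_ (trans (withoutV₁-first first (suc s) _)
                  (trans (withoutV₁-++ (fan 0 (suc (suc s)) (k ∸ 2)) (pathEdges (suc s) (k ∸ 2)))
                    (cong₂ _++_ (withoutV₁-fanV₁ (suc (suc s)) (k ∸ 2)) (withoutV₁-pathEdges s (k ∸ 2)))))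
                (withoutV₁-buildEdges false (s + (k ∸ 2)) c cs))

degV₁-++ : ∀ A B y → degV₁ (A ++ B) y ≡ degV₁ A y + degV₁ B y
degV₁-++ []            B y = refl
degV₁-++ ((u , v) ∷ A) B y = trans (cong (degV₁-edge u v y +_) (degV₁-++ A B y)) (sym (+-assoc (degV₁-edge u v y) _ _))

degV₁-fan : ∀ c s n y → degV₁ (fan (suc c) (suc s) n) y ≡ 0
degV₁-fan c s zero    y = refl
degV₁-fan c s (suc n) y = degV₁-fan c (suc s) n y

degV₁-pathEdges : ∀ s n y → degV₁ (pathEdges (suc s) n) y ≡ 0
degV₁-pathEdges s zero    y = refl
degV₁-pathEdges s (suc n) y = degV₁-pathEdges (suc s) n y

degV₁-fanV₁ : ∀ s n y → degV₁ (fan 0 (suc s) n) y ≡ inside s (suc (s + n)) 1 y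
degV₁-fanV₁ s zero y with y ≤? s
... | yes y≤s = sym (inside-below {t = suc (s + 0)} y≤s)
... | no y≰s  = sym (inside-above (subst (_≤ y) (cong suc (sym (+-identityʳ s))) (≰⇒> y≰s)))
degV₁-fanV₁ s (suc n) y with <-cmp (suc s) y
... | tri< 1+s<y _ _ = trans (cong₂ _+_ (↦-elsewhere (<⇒≢ 1+s<y)) (degV₁-fanV₁ (suc s) n y))
                         (trans (inside-shift {t = suc (suc s + n)} 1+s<y) (cong (λ t → inside s t 1 y) (cong suc (sym (+-suc s n)))))
... | tri≈ _ refl _  = trans (cong₂ _+_ (↦-here (suc s) 1)
                                     (trans (degV₁-fanV₁ (suc s) n (suc s)) (inside-below {suc s} {suc (suc s + n)} ≤-refl)))
                         (sym (inside-in {s} {suc (s + suc n)} ≤-refl (s≤s (subst (suc s ≤_) (sym (+-suc s n)) (s≤s (m≤m+n s n))))))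
... | tri> _ _ y<1+s = trans (cong₂ _+_ (↦-elsewhere (<⇒≢ y<1+s ∘ sym))
                                     (trans (degV₁-fanV₁ (suc s) n y) (inside-below {t = suc (suc s + n)} (<⇒≤ y<1+s))))
                         (sym (inside-below {t = suc (s + suc n)} (≤-pred y<1+s)))

degV₁-first : ∀ first s X y → degV₁ ((if first then (0 , s) ∷ [] else []) ++ X) y ≡ (if first then [ s ↦ 1 ] y else 0) + degV₁ X y
degV₁-first true  s X y = refl
degV₁-first false s X y = refl

degV₁-buildEdges : ∀ first s c cs y → degV₁ (buildEdges first (suc s) (suc c) cs) y ≡ chainDegV₁ first (suc s) (suc c) cs y
degV₁-buildEdges first s c [] y = refl
degV₁-buildEdges first s c (comp ordinary k ∷ cs) y =
  trans (degV₁-++ (compEdges first (suc s) (suc c) (comp ordinary k)) _ y)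
    (cong₂ _+_ (trans (degV₁-first first (suc s) _ y)
                 (cong ((if first then [ suc s ↦ 1 ] y else 0) +_) (cong ([ suc s + (k ∸ 2) ↦ 1 ] y +_)
                   (trans (cong ([ suc c ↦ 1 ] y +_)
                            (trans (degV₁-++ (fan (suc c) (suc s) (k ∸ 1)) (pathEdges (suc s) (k ∸ 2)) y)
                              (cong₂ _+_ (degV₁-fan c s (k ∸ 1) y) (degV₁-pathEdges s (k ∸ 2) y))))
                          (+-identityʳ _)))))
               (degV₁-buildEdges false (s + (k ∸ 2)) (suc c) cs y))
degV₁-buildEdges first s c (comp broken k ∷ cs) y =
  trans (degV₁-++ (compEdges first (suc s) (suc c) (comp broken k)) _ y)
    (cong₂ _+_ (trans (degV₁-first first (suc s) _ y)
                 (cong ((if first then [ suc s ↦ 1 ] y else 0) +_)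
                   (trans (degV₁-++ (fan 0 (suc (suc s)) (k ∸ 2)) (pathEdges (suc s) (k ∸ 2)) y)
                     (trans (cong₂ _+_ (degV₁-fanV₁ (suc s) (k ∸ 2) y) (degV₁-pathEdges s (k ∸ 2) y)) (+-identityʳ _)))))
               (degV₁-buildEdges false (s + (k ∸ 2)) c cs y))

chainTotal : Bool → Bool → ℕ → ℕ → List Comp → ℕ → ℕ
chainTotal seen first s c cs y = chainExp seen s c cs y + chainDegV₁ first s c cs y

chainTotal-∷ : ∀ seen first s c x cs y → chainTotal seen first s c (x ∷ cs) y ≡
  (blockExp seen s c x y + blockDegV₁ first s c x y) + chainTotal (seenAfter seen x) false (s + rimLength x) (nextCentre x c) cs y
chainTotal-∷ seen first s c x cs y = interchange (blockExp seen s c x y) _ (blockDegV₁ first s c x y) _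
  where open import Algebra.Properties.CommutativeSemigroup +-commutativeSemigroup using (interchange)

chainTotal-supported : ∀ seen first s c cs y → OutsideRim s (totalRim cs) y → OutsideCentres c (countOrd cs) y →
  chainTotal seen first s c cs y ≡ 0
chainTotal-supported seen first s c cs y out-rim out-c =
  cong₂ _+_ (chainExp-supported seen s c cs y out-rim out-c) (chainDegV₁-supported first s c cs y out-rim out-c)

blockTotal-outside : ∀ seen first s c x y → OutsideRim s (rimLength x) y → (y < c ⊎ nextCentre x c ≤ y) →
  blockExp seen s c x y + blockDegV₁ first s c x y ≡ 0
blockTotal-outside seen first s c x y out-rim out-c =
  cong₂ _+_ (blockExp-supported seen s c x y out-rim out-c) (blockDegV₁-supported first s c x y out-rim out-c)

chainTotal-start : ∀ seen s c x cs → WellSized (x ∷ cs) → s + totalRim (x ∷ cs) < c →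
  chainTotal seen false s c (x ∷ cs) s ≡ startExp seen x
chainTotal-start seen s c x@(comp kind (suc (suc (suc m)))) cs (s≤s (s≤s (s≤s _)) ∷ _) end<c =
  trans (chainTotal-∷ seen false s c x cs s)
    (trans (cong₂ _+_ (trans (cong₂ _+_ (blockExp-start kind) (blockDeg-start kind)) (+-identityʳ _))
                      (chainTotal-supported _ false t _ cs s (inj₁ s<t) (inj₁ (<-≤-trans (<-trans s<t t<c) (nextCentre-≤ x c)))))
           (+-identityʳ _))
  where
  t<c = block-fits s x cs end<c
  open BlockValues seen false s c m t<c

startExp≤1 : ∀ seen x → startExp seen x ≤ 1
startExp≤1 seen x with isEvenWheel x | seen
... | true  | _     = z≤n
... | false | true  = ≤-refl
... | false | false = z≤n

startExp-false : ∀ x → startExp false x ≡ 0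
startExp-false x with isEvenWheel x
... | true  = refl
... | false = refl

handoff : ∀ seen x x′ → endExp seen x + startExp (seenAfter seen x) x′ ≤ 1
handoff seen x x′ with isEvenWheel x | seen
... | true  | _     = startExp≤1 _ x′
... | false | true  = startExp≤1 true x′
... | false | false = s≤s (≤-reflexive (startExp-false x′))

rim-bound : ∀ cs seen first s c → WellSized cs → s + totalRim cs < c →
  ∀ y → s < y → y < s + totalRim cs → chainTotal seen first s c cs y ≤ 2
rim-bound [] seen first s c _ _ y s<y y<s+0 = ⊥-elim (<-asym s<y (subst (y <_) (+-identityʳ s) y<s+0))
rim-bound (x@(comp kind (suc (suc (suc m)))) ∷ cs) seen first s c (s≤s (s≤s (s≤s _)) ∷ sized) end<c y s<y y<end
  rewrite chainTotal-∷ seen first s c x cs y with <-cmp y (s + suc m)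
... | tri< y<t _ _ = ≤-reflexive (trans (cong₂ _+_ (blockTotal-inner kind y s<y y<t)
                       (chainTotal-supported _ false t _ cs y (inj₁ y<t) (inj₁ (<-≤-trans (<-trans y<t t<c) (nextCentre-≤ x c)))))
                       (+-identityʳ 2))
  where
  t<c = block-fits s x cs end<c
  open BlockValues seen first s c m t<c
... | tri≈ _ refl _ = shared-vertex cs sized (tail-fits s x cs end<c) y<end
  where
  t<c = block-fits s x cs end<c
  open BlockValues seen first s c m t<c
  shared-vertex : ∀ cs′ → WellSized cs′ → t + totalRim cs′ < c → t < s + totalRim (x ∷ cs′) →
    (blockExp seen s c x t + blockDegV₁ first s c x t) + chainTotal (seenAfter seen x) false t (nextCentre x c) cs′ t ≤ 2
  shared-vertex [] _ _ t<s+rim = ⊥-elim (<-irrefl (cong (s +_) (sym (+-identityʳ (suc m)))) t<s+rim)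
  shared-vertex (x′ ∷ cs′) sized′ t+rim<c _ =
    subst (_≤ 2) (sym (cong₂ _+_ (cong₂ _+_ (blockExp-end kind) (blockDeg-end kind))
                                  (chainTotal-start (seenAfter seen x) t (nextCentre x c) x′ cs′ sized′
                                    (<-≤-trans t+rim<c (nextCentre-≤ x c)))))
      (subst (_≤ 2) (cong (_+ startExp (seenAfter seen x) x′) (+-comm 1 (endExp seen x))) (s≤s (handoff seen x x′)))
... | tri> _ _ t<y = subst (_≤ 2) (sym (cong (_+ chainTotal (seenAfter seen x) false t (nextCentre x c) cs y)
                       (blockTotal-outside seen first s c x y (inj₂ t<y) (inj₁ (<-trans y<end end<c)))))
                       (rim-bound cs (seenAfter seen x) false t (nextCentre x c) sized
                         (<-≤-trans (tail-fits s x cs end<c) (nextCentre-≤ x c)) y t<y (subst (y <_) (totalRim-∷ s x cs) y<end))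
  where t = s + suc m

centre-bound : ∀ cs seen first s c → WellSized cs → s + totalRim cs < c → ∀ y → c ≤ y → chainTotal seen first s c cs y ≤ 4
centre-bound [] seen first s c _ _ y c≤y = z≤n
centre-bound (x@(comp ordinary (suc (suc (suc m)))) ∷ cs) seen first s c (s≤s (s≤s (s≤s _)) ∷ sized) end<c y c≤y
  rewrite chainTotal-∷ seen first s c x cs y with y ≟ c
... | yes refl = subst (_≤ 4) (sym (cong₂ _+_ (cong₂ _+_ ordExp-centre ordDeg-centre)
                   (chainTotal-supported _ false t (suc c) cs y (inj₂ (tail-fits s x cs end<c)) (inj₁ ≤-refl))))
                   (subst (_≤ 4) (cong (_+ 0) (+-comm 1 (centreExp x))) (s≤s (subst (_≤ 3) (sym (+-identityʳ _)) (centreExp≤3 x))))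
  where
  t<c = block-fits s x cs end<c
  open BlockValues seen first s c m t<c
  centreExp≤3 : ∀ x → centreExp x ≤ 3
  centreExp≤3 x with isEvenWheel x
  ... | true  = ≤-refl
  ... | false = s≤s (s≤s z≤n)
... | no y≢c = subst (_≤ 4) (sym (cong (_+ chainTotal (seenAfter seen x) false t (suc c) cs y)
                 (blockTotal-outside seen first s c x y (inj₂ (<-≤-trans (block-fits s x cs end<c) c≤y)) (inj₂ 1+c≤y))))
                 (centre-bound cs (seenAfter seen x) false t (suc c) sized (m<n⇒m<1+n (tail-fits s x cs end<c)) y 1+c≤y)
  where
  t = s + suc m
  1+c≤y : suc c ≤ y
  1+c≤y = ≤∧≢⇒< c≤y (y≢c ∘ sym)
centre-bound (x@(comp broken (suc (suc (suc m)))) ∷ cs) seen first s c (s≤s (s≤s (s≤s _)) ∷ sized) end<c y c≤y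
  rewrite chainTotal-∷ seen first s c x cs y =
  subst (_≤ 4) (sym (cong (_+ chainTotal (seenAfter seen x) false t c cs y)
    (blockTotal-outside seen first s c x y (inj₂ (<-≤-trans (block-fits s x cs end<c) c≤y)) (inj₂ c≤y))))
    (centre-bound cs (seenAfter seen x) false t c sized (tail-fits s x cs end<c) y c≤y)
  where t = s + suc m

endExp-after-even : ∀ seen x → seen ≡ true ⊎ isEvenWheel x ≡ true → endExp seen x ≡ 0
endExp-after-even seen x even with isEvenWheel x
endExp-after-even seen x even | true = refl
endExp-after-even .true x (inj₁ refl) | false = refl

totalRim-pos : ∀ x cs → WellSized (x ∷ cs) → 1 ≤ totalRim (x ∷ cs)
totalRim-pos (comp _ (suc (suc (suc m)))) cs (s≤s (s≤s (s≤s _)) ∷ _) = s≤s z≤n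

-- This is where the even wheel is needed.
chainExp-end : ∀ cs seen s c → WellSized cs → s + totalRim cs < c → seen ≡ true ⊎ Any (λ x → isEvenWheel x ≡ true) cs →
  chainExp seen s c cs (s + totalRim cs) ≡ 0
chainExp-end [] seen s c _ _ _ = refl
chainExp-end (x@(comp kind (suc (suc (suc m)))) ∷ []) seen s c (s≤s (s≤s (s≤s _)) ∷ _) end<c even =
  trans (+-identityʳ _) (trans (cong (blockExp seen s c x) (cong (s +_) (+-identityʳ (suc m))))
    (trans (blockExp-end kind) (endExp-after-even seen x (here-or-seen even))))
  where
  open BlockValues seen false s c m (block-fits s x [] end<c)
  here-or-seen : seen ≡ true ⊎ Any (λ x → isEvenWheel x ≡ true) (x ∷ []) → seen ≡ true ⊎ isEvenWheel x ≡ true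
  here-or-seen (inj₁ seen≡true)     = inj₁ seen≡true
  here-or-seen (inj₂ (here x-even)) = inj₂ x-even
chainExp-end (x@(comp kind (suc (suc (suc m)))) ∷ x′ ∷ cs) seen s c (s≤s (s≤s (s≤s _)) ∷ sized) end<c even =
  cong₂ _+_ (blockExp-supported seen s c x (s + totalRim (x ∷ x′ ∷ cs)) (inj₂ t<end) (inj₁ end<c))
    (trans (cong (chainExp (seenAfter seen x) t (nextCentre x c) (x′ ∷ cs)) (totalRim-∷ s x (x′ ∷ cs)))
      (chainExp-end (x′ ∷ cs) (seenAfter seen x) t (nextCentre x c) sized
        (<-≤-trans (tail-fits s x (x′ ∷ cs) end<c) (nextCentre-≤ x c)) (pass-on even)))
  where
  t = s + suc m
  t<end : t < s + totalRim (x ∷ x′ ∷ cs)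
  t<end = subst (t <_) (sym (totalRim-∷ s x (x′ ∷ cs)))
    (subst (_≤ t + totalRim (x′ ∷ cs)) (+-comm t 1) (+-monoʳ-≤ t (totalRim-pos x′ cs sized)))
  pass-on : seen ≡ true ⊎ Any (λ x → isEvenWheel x ≡ true) (x ∷ x′ ∷ cs) →
    seenAfter seen x ≡ true ⊎ Any (λ x → isEvenWheel x ≡ true) (x′ ∷ cs)
  pass-on (inj₁ refl)            = inj₁ refl
  pass-on (inj₂ (here x-even))   = inj₁ (trans (cong (seen ∨_) x-even) (∨-zeroʳ seen))
  pass-on (inj₂ (there later))   = inj₂ later

chainExp-start : ∀ cs s c → WellSized cs → s + totalRim cs < c → chainExp false s c cs s ≡ 0
chainExp-start []       s c _     _     = refl
chainExp-start (x ∷ cs) s c sized end<c = n≤0⇒n≡0 (subst (chainExp false s c (x ∷ cs) s ≤_)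
  (trans (chainTotal-start false s c x cs sized end<c) (startExp-false x)) (m≤m+n _ _))

tabulateℕ : (ℕ → ℕ) → ℕ → List ℕ
tabulateℕ g zero    = []
tabulateℕ g (suc n) = g 0 ∷ tabulateℕ (g ∘ suc) n

length-tabulateℕ : ∀ g n → length (tabulateℕ g n) ≡ n
length-tabulateℕ g zero    = refl
length-tabulateℕ g (suc n) = cong suc (length-tabulateℕ (g ∘ suc) n)

lookupD-tabulateℕ : ∀ g n y → y < n → lookupD (tabulateℕ g n) y ≡ g y
lookupD-tabulateℕ g (suc n) zero    _         = refl
lookupD-tabulateℕ g (suc n) (suc y) (s≤s y<n) = lookupD-tabulateℕ (g ∘ suc) n y y<n

lookupD-tabulateℕ-beyond : ∀ g n y → n ≤ y → lookupD (tabulateℕ g n) y ≡ 0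
lookupD-tabulateℕ-beyond g zero    y       _         = refl
lookupD-tabulateℕ-beyond g (suc n) (suc y) (s≤s n≤y) = lookupD-tabulateℕ-beyond (g ∘ suc) n y n≤y

lookupD-tabulateℕ-supported : ∀ g n → (∀ y → n ≤ y → g y ≡ 0) → ∀ y → lookupD (tabulateℕ g n) y ≡ g y
lookupD-tabulateℕ-supported g n g≡0 y with y <? n
... | yes y<n = lookupD-tabulateℕ g n y y<n
... | no y≮n  = trans (lookupD-tabulateℕ-beyond g n y (≮⇒≥ y≮n)) (sym (g≡0 y (≮⇒≥ y≮n)))

module _ (cs : List Comp) where

  private
    N c₀ : ℕ
    N  = outerEnd cs
    c₀ = suc N

  withoutV₁-minusPrincipal : withoutV₁ (minusPrincipal cs) ≡ rimChain 1 c₀ cs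
  withoutV₁-minusPrincipal = trans (withoutV₁-deleteEdge N (deleteEdge 0 1 (multiWheel cs)))
    (trans (withoutV₁-deleteEdge 1 (multiWheel cs)) (withoutV₁-buildEdges true 0 N cs))

  degV₁-minusPrincipal-≤ : ∀ y → degV₁ (minusPrincipal cs) y ≤ chainDegV₁ true 1 c₀ cs y
  degV₁-minusPrincipal-≤ y = ≤-trans (degV₁-deleteEdge-≤ N (deleteEdge 0 1 (multiWheel cs)) y)
    (≤-trans (degV₁-deleteEdge-≤ 1 (multiWheel cs) y) (≤-reflexive (degV₁-buildEdges true 0 N cs y)))

  degV₁-minusPrincipal-v₂ : degV₁ (minusPrincipal cs) 1 ≡ 0
  degV₁-minusPrincipal-v₂ = n≤0⇒n≡0 (subst (degV₁ (minusPrincipal cs) 1 ≤_) (degV₁-deleteEdge-self 1 (multiWheel cs))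
    (degV₁-deleteEdge-≤ N (deleteEdge 0 1 (multiWheel cs)) 1))

  degV₁-minusPrincipal-vₖ : degV₁ (minusPrincipal cs) N ≡ 0
  degV₁-minusPrincipal-vₖ = degV₁-deleteEdge-self N (deleteEdge 0 1 (multiWheel cs))

  -- The exponent of the monomial: the chain pattern plus the v₁-degrees, which the forced edges at v₁ use up.
  exponent : ℕ → ℕ
  exponent y = chainExp false 1 c₀ cs y + degV₁ (minusPrincipal cs) y

  exponent≤chainTotal : ∀ y → exponent y ≤ chainTotal false true 1 c₀ cs y
  exponent≤chainTotal y = +-monoʳ-≤ (chainExp false 1 c₀ cs y) (degV₁-minusPrincipal-≤ y)

  exponent-outside : ∀ y → OutsideRim 1 (totalRim cs) y → OutsideCentres c₀ (countOrd cs) y → exponent y ≡ 0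
  exponent-outside y out-rim out-c = n≤0⇒n≡0 (subst (exponent y ≤_) (chainTotal-supported false true 1 c₀ cs y out-rim out-c)
    (exponent≤chainTotal y))

  exponent-beyond : ∀ y → nVerts cs ≤ y → exponent y ≡ 0
  exponent-beyond y nV≤y = exponent-outside y (inj₂ (<-≤-trans (s≤s (m≤m+n N (countOrd cs))) nV≤y)) (inj₂ nV≤y)

  exponent-v₁ : exponent 0 ≡ 0
  exponent-v₁ = exponent-outside 0 (inj₁ (s≤s z≤n)) (inj₁ (s≤s z≤n))

  exponent-v₂ : WellSized cs → exponent 1 ≡ 0
  exponent-v₂ sized = cong₂ _+_ (chainExp-start cs 1 c₀ sized ≤-refl) degV₁-minusPrincipal-v₂

  exponent-vₖ : WellSized cs → Any IsEvenWheel cs → exponent N ≡ 0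
  exponent-vₖ sized even = cong₂ _+_ (chainExp-end cs false 1 c₀ sized ≤-refl (inj₂ (Any.map isEvenWheel-true even)))
    degV₁-minusPrincipal-vₖ
    where
    isEvenWheel-true : ∀ {x} → IsEvenWheel x → isEvenWheel x ≡ true
    isEvenWheel-true (evenWheel (divides q refl)) = isEven-*2 q
      where
      isEven-*2 : ∀ q → isEven (q * 2) ≡ true
      isEven-*2 zero    = refl
      isEven-*2 (suc q) = isEven-*2 q

  exponent-rim : WellSized cs → ∀ i → 2 ≤ i → i < N → exponent i ≤ 2
  exponent-rim sized i 2≤i i<N = ≤-trans (exponent≤chainTotal i) (rim-bound cs false true 1 c₀ sized ≤-refl i 2≤i i<N)

  exponent-centre : WellSized cs → ∀ j → N < j → exponent j ≤ 4
  exponent-centre sized j N<j = ≤-trans (exponent≤chainTotal j) (centre-bound cs false true 1 c₀ sized ≤-refl j N<j)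

  coeff-exponent≢0 : WellSized cs → coeff (minusPrincipal cs) (tabulateℕ exponent (nVerts cs)) ≢ 0ℤ
  coeff-exponent≢0 sized coeff≡0 = 1+n≢0 (begin
    1                                                          ≡⟨ cong₂ _*_ (sym (∣signV₁∣≡1 MP)) (sym ∣rest∣≡1) ⟩
    ∣ signV₁ MP ∣ * ∣ coeff (withoutV₁ MP) e′ ∣                ≡⟨ sym (ℤ.abs-* (signV₁ MP) _) ⟩
    ∣ signV₁ MP *ℤ coeff (withoutV₁ MP) e′ ∣                   ≡⟨ cong ∣_∣ (sym (coeff-withoutV₁ MP e e′ e0≡0 deg≤e e′≡)) ⟩
    ∣ coeff MP e ∣                                             ≡⟨ cong ∣_∣ coeff≡0 ⟩
    0                                                          ∎)
    where
    open ≡-Reasoning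
    MP = minusPrincipal cs
    pattern′ = chainExp false 1 c₀ cs
    e = tabulateℕ exponent (nVerts cs)
    e′ = tabulateℕ pattern′ (nVerts cs)
    pattern′-beyond : ∀ y → nVerts cs ≤ y → pattern′ y ≡ 0
    pattern′-beyond y nV≤y = chainExp-supported false 1 c₀ cs y (inj₂ (<-≤-trans (s≤s (m≤m+n N (countOrd cs))) nV≤y)) (inj₂ nV≤y)
    e≡ : ∀ y → lookupD e y ≡ exponent y
    e≡ = lookupD-tabulateℕ-supported exponent (nVerts cs) exponent-beyond
    e′≡ : ∀ y → lookupD e′ y ≡ lookupD e y ∸ degV₁ MP y
    e′≡ y = trans (lookupD-tabulateℕ-supported pattern′ (nVerts cs) pattern′-beyond y)
      (trans (sym (m+n∸n≡m (pattern′ y) (degV₁ MP y))) (cong (_∸ degV₁ MP y) (sym (e≡ y))))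
    e0≡0 : lookupD e 0 ≡ 0
    e0≡0 = trans (e≡ 0) exponent-v₁
    deg≤e : ∀ y → degV₁ MP y ≤ lookupD e y
    deg≤e y = subst (degV₁ MP y ≤_) (sym (e≡ y)) (m≤n+m _ _)
    ∣rest∣≡1 : ∣ coeff (withoutV₁ MP) e′ ∣ ≡ 1
    ∣rest∣≡1 rewrite withoutV₁-minusPrincipal =
      chain cs false 1 c₀ e′ sized ≤-refl (lookupD-tabulateℕ-supported pattern′ (nVerts cs) pattern′-beyond)

theorem5p8 : (cs : List Comp) → 2 ≤ length cs → All (λ c → 3 ≤ size c) cs → Any IsEvenWheel cs →
    ∃[ e ] (length e ≡ nVerts cs
    × lookupD e 0 ≡ 0 × lookupD e 1 ≡ 0 × lookupD e (outerEnd cs) ≡ 0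
    × (∀ i → 2 ≤ i → i < outerEnd cs → lookupD e i ≤ 2)
    × (∀ j → outerEnd cs < j → j < nVerts cs → lookupD e j ≤ 4)
    × coeff (minusPrincipal cs) e ≢ 0ℤ)
theorem5p8 cs _ sized even =
  tabulateℕ (exponent cs) nV , length-tabulateℕ (exponent cs) nV ,
  at 0 (s≤s z≤n) (exponent-v₁ cs) , at 1 1<nV (exponent-v₂ cs sized) , at N N<nV (exponent-vₖ cs sized even) ,
  (λ i 2≤i i<N → subst (_≤ 2) (sym (lookupD-tabulateℕ (exponent cs) nV i (<-trans i<N N<nV))) (exponent-rim cs sized i 2≤i i<N)) ,
  (λ j N<j j<nV → subst (_≤ 4) (sym (lookupD-tabulateℕ (exponent cs) nV j j<nV)) (exponent-centre cs sized j N<j)) ,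
  coeff-exponent≢0 cs sized
  where
  N = outerEnd cs
  nV = nVerts cs
  N<nV : N < nV
  N<nV = s≤s (m≤m+n N (countOrd cs))
  1<nV : 1 < nV
  1<nV = s≤s (s≤s z≤n)
  at : ∀ y → y < nV → exponent cs y ≡ 0 → lookupD (tabulateℕ (exponent cs) nV) y ≡ 0
  at y y<nV exp≡0 = trans (lookupD-tabulateℕ (exponent cs) nV y y<nV) exp≡0
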